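{- Let $\{\mathcal{F}^j=(\mathcal{F}^j_1,\dots,\mathcal{F}^j_r)\}_{j=1}^m$ be a family of flags of type $(t_1,\dots,t_r)$ on $\mathbb{F}_q^n$, let $a=\max\{i\mid 2t_i\leq n\}$, $b=\min\{i\mid 2t_i\geq n\}$, and let $\mathbf{H}$ be a subgroup of $\mathrm{GL}(n,q)$ such that every orbit $\mathrm{Orb}_{\mathbf{H}}(\mathcal{F}^j)$, $1\leq j\leq m$, is a disjoint flag code. If the subspaces $\mathcal{F}^1_a,\dots,\mathcal{F}^m_a$ lie in pairwise different $\mathbf{H}$-orbits and the subspaces $\mathcal{F}^1_b,\dots,\mathcal{F}^m_b$ lie in pairwise different $\mathbf{H}$-orbits, then $$\Big|\bigcup_{j=1}^m\mathrm{Orb}_{\mathbf{H}}(\mathcal{F}^j)\Big|=\sum_{j=1}^m|\mathrm{Orb}_{\mathbf{H}}(\mathcal{F}^j)|.$$ Moreover, under these hypotheses the following are equivalent: (i) $\bigcup_{j=1}^m\mathrm{Orb}_{\mathbf{H}}(\mathcal{F}^j)$ is an optimum distance flag code; (ii) the codes $\bigcup_{j=1}^m\mathrm{Orb}_{\mathbf{H}}(\mathcal{F}^j_a)$ and $\bigcup_{j=1}^m\mathrm{Orb}_{\mathbf{H}}(\mathcal{F}^j_b)$ have the maximum possible distance.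
   Context: A flag of type $(t_1,\dots,t_r)$, $0<t_1<\dots<t_r<n$, is a chain $\mathcal{F}_1\subsetneq\cdots\subsetneq\mathcal{F}_r$ of subspaces of $\mathbb{F}_q^n$ with $\dim\mathcal{F}_i=t_i$. A flag code is a nonempty set $\mathcal{C}$ of flags of a fixed type; its $i$-th projected code is $\mathcal{C}_i=\{\mathcal{F}_i\mid\mathcal{F}\in\mathcal{C}\}$; $\mathcal{C}$ is disjoint if $|\mathcal{C}|=|\mathcal{C}_1|=\dots=|\mathcal{C}_r|$. $\mathrm{GL}(n,q)$ acts on subspaces by $\mathcal{V}\cdot A=\mathrm{rowsp}(VA)$ where $\mathcal{V}=\mathrm{rowsp}(V)$, and on flags componentwise. $d_S(\mathcal{U},\mathcal{V})=\dim(\mathcal{U}+\mathcal{V})-\dim(\mathcal{U}\cap\mathcal{V})$; a set of $k$-dimensional subspaces has maximum (possible) distance if its minimum distance between distinct members (defined as $0$ for a single element) equals $2k$ when $2k\leq n$ and $2(n-k)$ when $2k\geq n$. With $d_f(\mathcal{F},\mathcal{F}')=\sum_i d_S(\mathcal{F}_i,\mathcal{F}'_i)$ and $d_f(\mathcal{C})$ the least flag distance between distinct members ($0$ if $|\mathcal{C}|=1$), $\mathcal{C}$ is an optimum distance flag code if $d_f(\mathcal{C})=2\left(\sum_{2t_i\leq n}t_i+\sum_{2t_i>n}(n-t_i)\right)$. If one of the indices $a,b$ does not exist (its defining set is empty), conditions referring to it are omitted. -}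

module Defs where

open import Level using (Level; _⊔_) renaming (suc to lsuc; zero to lzero)
open import Data.Nat using (ℕ; zero; suc; _≤_; _<_; _∸_; _≤ᵇ_) renaming (_+_ to _+ℕ_; _*_ to _*ℕ_)
open import Data.Fin as Fin using (Fin; zero; suc)
open import Data.Bool using (if_then_else_)
open import Data.Product using (Σ; _×_; _,_)
open import Data.Sum using (_⊎_)
open import Relation.Nullary using (¬_; ⌊_⌋)
open import Relation.Binary.PropositionalEquality using (_≡_; _≢_)
open import Algebra.Structures using (IsCommutativeRing)
open import Function.Bundles using (_↔_)

sumℕ : {k : ℕ} → (Fin k → ℕ) → ℕ
sumℕ {zero} f = 0
sumℕ {suc k} f = f zero +ℕ sumℕ (λ i → f (suc i))

-- A finite field with q elements (field equality is propositional equality;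
-- every finite field has such a representation, e.g. on Fin q).
record FiniteField (q : ℕ) : Set₁ where
  field
    Carrier : Set
    _+_ _*_ : Carrier → Carrier → Carrier
    -_ : Carrier → Carrier
    0# 1# : Carrier
    isCommutativeRing : IsCommutativeRing _≡_ _+_ _*_ -_ 0# 1#
    0≢1 : 0# ≢ 1#
    inverse : ∀ x → x ≢ 0# → Σ Carrier (λ y → x * y ≡ 1#)
    enumeration : Carrier ↔ Fin q

HasCard : {ℓ : Level} {A : Set₁} → (A → A → Set) → (A → Set ℓ) → ℕ → Set (lsuc lzero ⊔ ℓ)
HasCard {ℓ} {A} _≈_ S k =
  Σ (Fin k → A) λ e →
    (∀ i → S (e i)) ×
    (∀ i j → e i ≈ e j → i ≡ j) ×
    (∀ x → S x → Σ (Fin k) λ i → x ≈ e i)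

-- Generic minimum distance of a code S (0 when there are no two distinct elements),
-- where dist x y d means "the distance between x and y is d".
MinDist : {ℓ : Level} {A : Set₁} → (A → A → Set) → (A → A → ℕ → Set) → (A → Set ℓ) → ℕ → Set (lsuc lzero ⊔ ℓ)
MinDist {ℓ} {A} _≈_ dist S d =
  ((Σ A λ x → Σ A λ y → S x × S y × ¬ (x ≈ y) × dist x y d) ×
   (∀ x y e → S x → S y → ¬ (x ≈ y) → dist x y e → d ≤ e))
  ⊎ ((∀ x y → S x → S y → x ≈ y) × d ≡ 0)

module _ {q : ℕ} (𝔽 : FiniteField q) (n : ℕ) where
  open FiniteField 𝔽

  sumF : {k : ℕ} → (Fin k → Carrier) → Carrier
  sumF {zero} f = 0#
  sumF {suc k} f = f zero + sumF (λ i → f (suc i))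

  Vect : Set
  Vect = Fin n → Carrier

  _≋_ : Vect → Vect → Set
  u ≋ v = ∀ i → u i ≡ v i

  zeroV : Vect
  zeroV _ = 0#

  _⊕_ : Vect → Vect → Vect
  (u ⊕ v) i = u i + v i

  _·_ : Carrier → Vect → Vect
  (c · v) i = c * v i

  sumV : {k : ℕ} → (Fin k → Vect) → Vect
  sumV {zero} f = zeroV
  sumV {suc k} f = f zero ⊕ sumV (λ i → f (suc i))

  linComb : {k : ℕ} → (Fin k → Vect) → (Fin k → Carrier) → Vect
  linComb b c = sumV (λ i → c i · b i)

  IsBasis : (Vect → Set) → {k : ℕ} → (Fin k → Vect) → Set
  IsBasis P b =
    (∀ c → linComb b c ≋ zeroV → ∀ i → c i ≡ 0#) ×
    (∀ c → P (linComb b c)) ×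
    (∀ v → P v → Σ _ λ c → v ≋ linComb b c)

  HasDim : (Vect → Set) → ℕ → Set
  HasDim P k = Σ (Fin k → Vect) (IsBasis P)

  record Subspace : Set₁ where
    field
      mem : Vect → Set
      mem-resp : ∀ {u v} → u ≋ v → mem u → mem v
      mem-0 : mem zeroV
      mem-+ : ∀ {u v} → mem u → mem v → mem (u ⊕ v)
      mem-· : ∀ c {v} → mem v → mem (c · v)
  open Subspace public

  SameP : (Vect → Set) → (Vect → Set) → Set
  SameP P Q = ∀ v → (P v → Q v) × (Q v → P v)

  _≈S_ : Subspace → Subspace → Set
  U ≈S V = SameP (mem U) (mem V)

  sumP : Subspace → Subspace → Vect → Set
  sumP U V w = Σ Vect λ u → Σ Vect λ v → mem U u × mem V v × w ≋ (u ⊕ v)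

  capP : Subspace → Subspace → Vect → Set
  capP U V w = mem U w × mem V w

  DistS : Subspace → Subspace → ℕ → Set
  DistS U V d = Σ ℕ λ s → Σ ℕ λ i →
    HasDim (sumP U V) s × HasDim (capP U V) i × d ≡ s ∸ i

  Mat : Set
  Mat = Fin n → Fin n → Carrier

  _≋M_ : Mat → Mat → Set
  A ≋M B = ∀ i j → A i j ≡ B i j

  idM : Mat
  idM i j = if ⌊ i Fin.≟ j ⌋ then 1# else 0#

  _⊗_ : Mat → Mat → Mat
  (A ⊗ B) i j = sumF (λ k → A i k * B k j)

  _▸_ : Vect → Mat → Vect
  (v ▸ A) j = sumF (λ i → v i * A i j)

  record Subgroup : Set₁ where
    field
      elem : Mat → Set
      elem-resp : ∀ {A B} → A ≋M B → elem A → elem B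
      elem-id : elem idM
      elem-mul : ∀ {A B} → elem A → elem B → elem (A ⊗ B)
      elem-inv : ∀ {A} → elem A →
        Σ Mat λ B → elem B × (A ⊗ B) ≋M idM × (B ⊗ A) ≋M idM
  open Subgroup public

  actP : Subspace → Mat → Vect → Set
  actP U A w = Σ Vect λ v → mem U v × w ≋ (v ▸ A)

  OrbS : Subgroup → Subspace → Subspace → Set
  OrbS H U U' = Σ Mat λ A → elem H A × SameP (mem U') (actP U A)

  module _ {r : ℕ} (t : Fin r → ℕ) where

    record Flag : Set₁ where
      field
        sub : Fin r → Subspace
        sub-dim : ∀ i → HasDim (mem (sub i)) (t i)
        sub-nested : ∀ i j → i Fin.≤ j → ∀ v → mem (sub i) v → mem (sub j) v
    open Flag public

    _≈F_ : Flag → Flag → Set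
    F ≈F F' = ∀ i → sub F i ≈S sub F' i

    OrbF : Subgroup → Flag → Flag → Set
    OrbF H F F' = Σ Mat λ A → elem H A × (∀ i → SameP (mem (sub F' i)) (actP (sub F i) A))

    Proj : (Flag → Set) → Fin r → Subspace → Set₁
    Proj C i U = Σ Flag λ F → C F × U ≈S sub F i

    IsDisjoint : (Flag → Set) → Set₁
    IsDisjoint C = Σ ℕ λ k → HasCard _≈F_ C k × (∀ i → HasCard _≈S_ (Proj C i) k)

    DistF : Flag → Flag → ℕ → Set
    DistF F F' d = Σ (Fin r → ℕ) λ ds →
      (∀ i → DistS (sub F i) (sub F' i) (ds i)) × d ≡ sumℕ ds

    IsOptimum : (Flag → Set) → Set₁
    IsOptimum C = MinDist _≈F_ DistF C
      (2 *ℕ sumℕ (λ i → if (2 *ℕ t i) ≤ᵇ n then t i else n ∸ t i))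

  MaxDistS : ℕ → (Subspace → Set) → Set₁
  MaxDistS k C = MinDist _≈S_ DistS C
    (if (2 *ℕ k) ≤ᵇ n then 2 *ℕ k else 2 *ℕ (n ∸ k))

IsType : (n : ℕ) {r : ℕ} → (Fin r → ℕ) → Set
IsType n t = (∀ i → 0 < t i) × (∀ i → t i < n) × (∀ i j → i Fin.< j → t i < t j)

module _ (n : ℕ) {r : ℕ} (t : Fin r → ℕ) where

  IsA : Fin r → Set
  IsA i = 2 *ℕ t i ≤ n × (∀ k → 2 *ℕ t k ≤ n → k Fin.≤ i)

  IsB : Fin r → Set
  IsB i = n ≤ 2 *ℕ t i × (∀ k → n ≤ 2 *ℕ t k → i Fin.≤ k)

{-# OPTIONS --safe #-}
module Submission where

-- Separation at a single index (an a or a b exists since r > 0) keeps the orbits of the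
-- Fⱼ apart, so the union is disjoint and cardinalities add.  Two k-dimensional subspaces
-- are at distance at most 2 min(k, n − k), so the union is an optimum distance code exactly
-- when every two distinct flags in it attain this bound in every component.  Distinct flags
-- of the union have distinct a- and b-subspaces: within one orbit because the orbit is a
-- disjoint code, across orbits by the separation hypotheses.  By Grassmann, maximal distance
-- at a means F_a ∩ F'_a = 0, which descends to every i ≤ a, and maximal distance at b means
-- F_b + F'_b = 𝔽_q^n, which ascends to every i ≥ b; every index lies below a or above b.

open import Defs
open import Level using (_⊔_) renaming (suc to lsuc; zero to lzero)
open import Data.Nat as ℕ using (ℕ; zero; suc; _≤_; _<_; z≤n; s≤s; _∸_; _^_; _≤ᵇ_)
import Data.Nat.Properties as ℕ
open import Data.Nat.Tactic.RingSolver using (solve-∀)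
open import Data.Fin as Fin using (Fin; zero; suc; splitAt; funToFin; finToFun)
import Data.Fin.Properties as Fin
open import Data.Vec.Functional using (_++_; _∷_; zipWith; take; drop)
open import Data.Vec.Functional.Properties using (++-cong; ++-injectiveˡ; lookup-++ˡ; lookup-++ʳ)
open import Data.Product using (Σ; _×_; _,_; proj₁; proj₂)
open import Data.Sum using (_⊎_; inj₁; inj₂; [_,_]; [_,_]′)
open import Data.Sum.Properties using ([,]-map; [,]-∘)
open import Data.Unit using (⊤; tt)
open import Data.Bool using (true; false; if_then_else_; T)
open import Data.Maybe using (nothing)
open import Function using (_∘_; id; _⇔_; mk⇔; Equivalence; Inverse)
open import Relation.Nullary using (¬_; Dec; yes; no; ⌊_⌋; contradiction)
open import Relation.Unary using (Decidable)
open import Relation.Binary.PropositionalEquality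
  using (_≡_; _≢_; refl; sym; trans; cong; cong₂; subst; _≗_; module ≡-Reasoning)
open import Algebra.Bundles using (CommutativeRing)
open import Tactic.RingSolver.Core.AlmostCommutativeRing using (fromCommutativeRing)

tail-++ : ∀ {a} {A : Set a} {m k} (f : Fin (suc m) → A) (g : Fin k → A) → (f ++ g) ∘ suc ≗ (f ∘ suc) ++ g
tail-++ {m = m} f g i = [,]-map (splitAt m i)

zipWith-++ : ∀ {a b c} {A : Set a} {B : Set b} {C : Set c} {m k} (f : A → B → C)
  (x : Fin m → A) (x' : Fin k → A) (y : Fin m → B) (y' : Fin k → B) →
  zipWith f (x ++ x') (y ++ y') ≗ zipWith f x y ++ zipWith f x' y'
zipWith-++ {m = m} f x x' y y' i with splitAt m i
... | inj₁ _ = refl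
... | inj₂ _ = refl

take-++-drop : ∀ {a} {A : Set a} m {k} (c : Fin (m ℕ.+ k) → A) → take m c ++ drop m c ≗ c
take-++-drop m c i = trans (sym ([,]-∘ c (splitAt m i))) (cong c (Fin.join-splitAt m _ i))

take-drop-≗ : ∀ {a} {A : Set a} m {k} {c c' : Fin (m ℕ.+ k) → A} → take m c ≗ take m c' → drop m c ≗ drop m c' → c ≗ c'
take-drop-≗ m {c = c} {c'} take≗ drop≗ i =
  trans (sym (take-++-drop m c i)) (trans (++-cong (take m c) (take m c') take≗ drop≗ i) (take-++-drop m c' i))

All-++ : ∀ {a p} {A : Set a} (P : A → Set p) {m k} {u : Fin m → A} {w : Fin k → A} →
  (∀ j → P (u j)) → (∀ j → P (w j)) → ∀ j → P ((u ++ w) j)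
All-++ P {m} Pu Pw j with splitAt m j
... | inj₁ j = Pu j
... | inj₂ j = Pw j

funToFin-cong : ∀ {m k} {f g : Fin m → Fin k} → f ≗ g → funToFin f ≡ funToFin g
funToFin-cong {zero} f≗g = refl
funToFin-cong {suc m} f≗g = cong₂ Fin.combine (f≗g zero) (funToFin-cong (f≗g ∘ suc))

+-shuffle : ∀ m₁ m₂ i → m₁ ℕ.+ (m₂ ℕ.+ i) ℕ.+ i ≡ (m₁ ℕ.+ i) ℕ.+ (m₂ ℕ.+ i)
+-shuffle = solve-∀

module LinearAlgebra {q : ℕ} (𝔽 : FiniteField q) (n : ℕ) where
  open FiniteField 𝔽 renaming (Carrier to K; _+_ to infixl 6 _+_; _*_ to infixl 7 _*_; -_ to infix 8 -_)

  ring : CommutativeRing lzero lzero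
  ring = record { isCommutativeRing = isCommutativeRing }

  open CommutativeRing ring using
    ( +-identityˡ; +-identityʳ; +-assoc; *-assoc; *-comm; distribʳ; distribˡ
    ; zeroˡ; zeroʳ; *-identityˡ; *-identityʳ; -‿inverseʳ)
  open import Algebra.Properties.Ring (CommutativeRing.ring ring) using (-‿distribˡ-*; -‿distribʳ-*)
  open import Algebra.Properties.Group (CommutativeRing.+-group ring)
    using (inverseʳ-unique; ⁻¹-involutive; ε⁻¹≈ε; x∙y⁻¹≈ε⇒x≈y)
  -- With no zero test on coefficients (λ _ → nothing) the solver only proves identities
  -- that hold monomial by monomial, such as rearrangements of sums.
  open import Tactic.RingSolver.NonReflective (fromCommutativeRing ring (λ _ → nothing))
    using (solve; _⊜_) renaming (_⊕_ to infixl 16 _:+_; ⊝_ to infix 18 :-_)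

  ∑ : ∀ {k} → (Fin k → K) → K
  ∑ = sumF 𝔽 n

  ∑-cong : ∀ {k} {f g : Fin k → K} → f ≗ g → ∑ f ≡ ∑ g
  ∑-cong {zero} f≗g = refl
  ∑-cong {suc k} f≗g = cong₂ _+_ (f≗g zero) (∑-cong (f≗g ∘ suc))

  ∑-0 : ∀ {k} → ∑ {k} (λ _ → 0#) ≡ 0#
  ∑-0 {zero} = refl
  ∑-0 {suc k} = trans (cong (0# +_) (∑-0 {k})) (+-identityˡ 0#)

  ∑-+ : ∀ {k} (f g : Fin k → K) → ∑ (λ i → f i + g i) ≡ ∑ f + ∑ g
  ∑-+ {zero} f g = sym (+-identityˡ 0#)
  ∑-+ {suc k} f g = trans (cong (f zero + g zero +_) (∑-+ (f ∘ suc) (g ∘ suc)))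
    (solve 4 (λ a b c d → a :+ b :+ (c :+ d) ⊜ a :+ c :+ (b :+ d)) refl (f zero) (g zero) (∑ (f ∘ suc)) (∑ (g ∘ suc)))

  ∑-*ˡ : ∀ {k} c (f : Fin k → K) → ∑ (λ i → c * f i) ≡ c * ∑ f
  ∑-*ˡ {zero} c f = sym (zeroʳ c)
  ∑-*ˡ {suc k} c f = trans (cong (c * f zero +_) (∑-*ˡ c (f ∘ suc)))
    (sym (distribˡ c (f zero) (∑ (f ∘ suc))))

  ∑-*ʳ : ∀ {k} c (f : Fin k → K) → ∑ (λ i → f i * c) ≡ ∑ f * c
  ∑-*ʳ c f = trans (∑-cong (λ i → *-comm (f i) c)) (trans (∑-*ˡ c f) (*-comm c (∑ f)))

  ∑-neg : ∀ {k} (f : Fin k → K) → ∑ (λ i → - f i) ≡ - ∑ f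
  ∑-neg {zero} f = sym ε⁻¹≈ε
  ∑-neg {suc k} f = trans (cong (- f zero +_) (∑-neg (f ∘ suc)))
    (solve 2 (λ a b → :- a :+ :- b ⊜ :- (a :+ b)) refl (f zero) (∑ (f ∘ suc)))

  ∑-comm : ∀ {k l} (M : Fin k → Fin l → K) → ∑ (λ i → ∑ (M i)) ≡ ∑ (λ j → ∑ (λ i → M i j))
  ∑-comm {zero} {l} M = sym (∑-0 {l})
  ∑-comm {suc k} M = trans (cong (∑ (M zero) +_) (∑-comm (M ∘ suc)))
    (sym (∑-+ (M zero) (λ j → ∑ (λ i → M (suc i) j))))

  ∑-*-∑ : ∀ {k l} (a : Fin k → K) (B : Fin k → Fin l → K) (c : Fin l → K) →
    ∑ (λ i → a i * ∑ (λ m → B i m * c m)) ≡ ∑ (λ m → ∑ (λ i → a i * B i m) * c m)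
  ∑-*-∑ a B c = begin
    ∑ (λ i → a i * ∑ (λ m → B i m * c m))    ≡⟨ ∑-cong (λ i → sym (∑-*ˡ (a i) (λ m → B i m * c m))) ⟩
    ∑ (λ i → ∑ (λ m → a i * (B i m * c m)))  ≡⟨ ∑-cong (λ i → ∑-cong (λ m → sym (*-assoc (a i) (B i m) (c m)))) ⟩
    ∑ (λ i → ∑ (λ m → a i * B i m * c m))    ≡⟨ ∑-comm (λ i m → a i * B i m * c m) ⟩
    ∑ (λ m → ∑ (λ i → a i * B i m * c m))    ≡⟨ ∑-cong (λ m → ∑-*ʳ (c m) (λ i → a i * B i m)) ⟩
    ∑ (λ m → ∑ (λ i → a i * B i m) * c m)    ∎
    where open ≡-Reasoning

  ∑-++ : ∀ {m k} (f : Fin m → K) (g : Fin k → K) → ∑ (f ++ g) ≡ ∑ f + ∑ g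
  ∑-++ {zero} f g = sym (+-identityˡ (∑ g))
  ∑-++ {suc m} f g = trans (cong (f zero +_) (trans (∑-cong (tail-++ f g)) (∑-++ (f ∘ suc) g)))
    (sym (+-assoc (f zero) (∑ (f ∘ suc)) (∑ g)))

  δ : ∀ {k} → Fin k → Fin k → K
  δ i j = if ⌊ i Fin.≟ j ⌋ then 1# else 0#

  ∑-δ : ∀ {k} (f : Fin k → K) j → ∑ (λ i → f i * δ i j) ≡ f j
  ∑-δ {suc k} f zero =
    trans (cong₂ _+_ (*-identityʳ (f zero)) (trans (∑-cong (λ i → zeroʳ (f (suc i)))) (∑-0 {k})))
      (+-identityʳ (f zero))
  ∑-δ {suc k} f (suc j) =
    trans (cong₂ _+_ (zeroʳ (f zero)) (trans (∑-cong (λ i → cong (f (suc i) *_) (δ-suc i j))) (∑-δ (f ∘ suc) j)))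
      (+-identityˡ (f (suc j)))
    where
    δ-suc : ∀ {k} (i j : Fin k) → δ (suc i) (suc j) ≡ δ i j
    δ-suc i j with i Fin.≟ j
    ... | yes _ = refl
    ... | no _ = refl

  V : Set
  V = Vect 𝔽 n

  infix 4 _≈_
  _≈_ : V → V → Set
  _≈_ = _≋_ 𝔽 n

  infixl 6 _+ᵥ_
  _+ᵥ_ : V → V → V
  _+ᵥ_ = _⊕_ 𝔽 n

  infixr 7 _·ᵥ_
  _·ᵥ_ : K → V → V
  _·ᵥ_ = _·_ 𝔽 n

  0ᵥ : V
  0ᵥ = zeroV 𝔽 n

  ≈-refl : ∀ {u} → u ≈ u
  ≈-refl i = refl

  ≈-sym : ∀ {u v} → u ≈ v → v ≈ u
  ≈-sym u≈v i = sym (u≈v i)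

  ≈-trans : ∀ {u v w} → u ≈ v → v ≈ w → u ≈ w
  ≈-trans u≈v v≈w i = trans (u≈v i) (v≈w i)

  SameP-refl : ∀ {P : V → Set} → SameP 𝔽 n P P
  SameP-refl v = id , id

  SameP-sym : ∀ {P Q : V → Set} → SameP 𝔽 n P Q → SameP 𝔽 n Q P
  SameP-sym P≡Q v = proj₂ (P≡Q v) , proj₁ (P≡Q v)

  SameP-trans : ∀ {P Q R : V → Set} → SameP 𝔽 n P Q → SameP 𝔽 n Q R → SameP 𝔽 n P R
  SameP-trans P≡Q Q≡R v = proj₁ (Q≡R v) ∘ proj₁ (P≡Q v) , proj₂ (P≡Q v) ∘ proj₂ (Q≡R v)

  SameP-≉-resp : ∀ {P P' Q Q' : V → Set} → SameP 𝔽 n P Q → SameP 𝔽 n P' Q' → ¬ SameP 𝔽 n P P' → ¬ SameP 𝔽 n Q Q'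
  SameP-≉-resp P≡Q P'≡Q' P≉P' Q≡Q' = P≉P' (SameP-trans P≡Q (SameP-trans Q≡Q' (SameP-sym P'≡Q')))

  lc : ∀ {k} → (Fin k → V) → (Fin k → K) → V
  lc = linComb 𝔽 n

  sumV-apply : ∀ {k} (f : Fin k → V) j → sumV 𝔽 n f j ≡ ∑ (λ i → f i j)
  sumV-apply {zero} f j = refl
  sumV-apply {suc k} f j = cong (f zero j +_) (sumV-apply (f ∘ suc) j)

  lc-apply : ∀ {k} (b : Fin k → V) c j → lc b c j ≡ ∑ (λ i → c i * b i j)
  lc-apply b c = sumV-apply (λ i → c i ·ᵥ b i)

  lc-cong : ∀ {k} {b b' : Fin k → V} {c c' : Fin k → K} → (∀ i → b i ≈ b' i) → c ≗ c' → lc b c ≈ lc b' c'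
  lc-cong {b = b} {b'} {c} {c'} b≈b' c≗c' j =
    trans (lc-apply b c j) (trans (∑-cong (λ i → cong₂ _*_ (c≗c' i) (b≈b' i j))) (sym (lc-apply b' c' j)))

  lc-+ : ∀ {k} (b : Fin k → V) c c' → lc b (λ i → c i + c' i) ≈ lc b c +ᵥ lc b c'
  lc-+ b c c' j = begin
    lc b (λ i → c i + c' i) j                       ≡⟨ lc-apply b _ j ⟩
    ∑ (λ i → (c i + c' i) * b i j)                  ≡⟨ ∑-cong (λ i → distribʳ (b i j) (c i) (c' i)) ⟩
    ∑ (λ i → c i * b i j + c' i * b i j)            ≡⟨ ∑-+ (λ i → c i * b i j) (λ i → c' i * b i j) ⟩
    ∑ (λ i → c i * b i j) + ∑ (λ i → c' i * b i j)  ≡⟨ cong₂ _+_ (lc-apply b c j) (lc-apply b c' j) ⟨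
    lc b c j + lc b c' j                            ∎
    where open ≡-Reasoning

  lc-· : ∀ {k} (b : Fin k → V) a c → lc b (λ i → a * c i) ≈ a ·ᵥ lc b c
  lc-· b a c j = trans (lc-apply b _ j) (trans (∑-cong (λ i → *-assoc a (c i) (b i j)))
    (trans (∑-*ˡ a (λ i → c i * b i j)) (cong (a *_) (sym (lc-apply b c j)))))

  lc-neg : ∀ {k} (b : Fin k → V) c j → lc b (λ i → - c i) j ≡ - lc b c j
  lc-neg b c j = trans (lc-apply b _ j) (trans (∑-cong (λ i → sym (-‿distribˡ-* (c i) (b i j))))
    (trans (∑-neg (λ i → c i * b i j)) (cong -_ (sym (lc-apply b c j)))))

  lc-0 : ∀ {k} (b : Fin k → V) → lc b (λ _ → 0#) ≈ 0ᵥ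
  lc-0 {k} b j = trans (lc-apply b _ j) (trans (∑-cong (λ i → zeroˡ (b i j))) (∑-0 {k}))

  lc-δ : ∀ {k} (b : Fin k → V) l → lc b (λ i → δ i l) ≈ b l
  lc-δ b l j = trans (lc-apply b _ j) (trans (∑-cong (λ i → *-comm (δ i l) (b i j))) (∑-δ (λ i → b i j) l))

  lc-++ : ∀ {m k} (u : Fin m → V) (w : Fin k → V) c d → lc (u ++ w) (c ++ d) ≈ lc u c +ᵥ lc w d
  lc-++ {m} u w c d j = begin
    lc (u ++ w) (c ++ d) j                              ≡⟨ lc-apply (u ++ w) (c ++ d) j ⟩
    ∑ (λ i → (c ++ d) i * (u ++ w) i j)                 ≡⟨ ∑-cong (zipWith-++ (λ a x → a * x j) c d u w) ⟩
    ∑ ((λ i → c i * u i j) ++ (λ i → d i * w i j))       ≡⟨ ∑-++ (λ i → c i * u i j) (λ i → d i * w i j) ⟩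
    ∑ (λ i → c i * u i j) + ∑ (λ i → d i * w i j)         ≡⟨ cong₂ _+_ (lc-apply u c j) (lc-apply w d j) ⟨
    lc u c j + lc w d j                                  ∎
    where open ≡-Reasoning

  Independent : ∀ {k} → (Fin k → V) → Set
  Independent b = ∀ c → lc b c ≈ 0ᵥ → ∀ i → c i ≡ 0#

  InSpan : ∀ {k} → (Fin k → V) → V → Set
  InSpan {k} b v = Σ (Fin k → K) λ c → v ≈ lc b c

  InSpan-resp : ∀ {k} {b : Fin k → V} {u v} → u ≈ v → InSpan b u → InSpan b v
  InSpan-resp u≈v (c , u≈bc) = c , ≈-trans (≈-sym u≈v) u≈bc

  InSpan-self : ∀ {k} (b : Fin k → V) l → InSpan b (b l)
  InSpan-self b l = (λ i → δ i l) , ≈-sym (lc-δ b l)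

  span : ∀ {k} → (Fin k → V) → Subspace 𝔽 n
  span b = record
    { mem = InSpan b
    ; mem-resp = InSpan-resp
    ; mem-0 = (λ _ → 0#) , ≈-sym (lc-0 b)
    ; mem-+ = λ (c , u≈) (c' , v≈) → (λ i → c i + c' i) , ≈-trans (λ j → cong₂ _+_ (u≈ j) (v≈ j)) (≈-sym (lc-+ b c c'))
    ; mem-· = λ a (c , v≈) → (λ i → a * c i) , ≈-trans (λ j → cong (a *_) (v≈ j)) (≈-sym (lc-· b a c))
    }

  Independent⇒lc-injective : ∀ {k} {b : Fin k → V} → Independent b → ∀ c c' → lc b c ≈ lc b c' → c ≗ c'
  Independent⇒lc-injective {b = b} indep c c' bc≈bc' i = x∙y⁻¹≈ε⇒x≈y (c i) (c' i) (indep (λ i → c i + - c' i) (λ j → begin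
    lc b (λ i → c i + - c' i) j        ≡⟨ lc-+ b c (λ i → - c' i) j ⟩
    lc b c j + lc b (λ i → - c' i) j   ≡⟨ cong₂ _+_ (bc≈bc' j) (lc-neg b c' j) ⟩
    lc b c' j + - lc b c' j            ≡⟨ -‿inverseʳ (lc b c' j) ⟩
    0#                                  ∎) i)
    where open ≡-Reasoning

  mem-lc : (U : Subspace 𝔽 n) → ∀ {k} (b : Fin k → V) c → (∀ i → mem U (b i)) → mem U (lc b c)
  mem-lc U {zero} b c b∈U = mem-0 U
  mem-lc U {suc k} b c b∈U =
    mem-+ U (mem-· U (c zero) (b∈U zero)) (mem-lc U (b ∘ suc) (c ∘ suc) (b∈U ∘ suc))

  toFin : K → Fin q
  toFin = Inverse.to enumeration

  fromFin : Fin q → K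
  fromFin = Inverse.from enumeration

  toFin-injective : ∀ {x y} → toFin x ≡ toFin y → x ≡ y
  toFin-injective {x} {y} eq = trans (sym (Inverse.strictlyInverseʳ enumeration x))
    (trans (cong fromFin eq) (Inverse.strictlyInverseʳ enumeration y))

  fromFin-injective : ∀ {x y} → fromFin x ≡ fromFin y → x ≡ y
  fromFin-injective {x} {y} eq = trans (sym (Inverse.strictlyInverseˡ enumeration x))
    (trans (cong toFin eq) (Inverse.strictlyInverseˡ enumeration y))

  coeffs : ∀ {k} → Fin (q ^ k) → Fin k → K
  coeffs x = fromFin ∘ finToFun x

  index : ∀ {k} → (Fin k → K) → Fin (q ^ k)
  index c = funToFin (toFin ∘ c)

  coeffs-index : ∀ {k} (c : Fin k → K) → coeffs (index c) ≗ c
  coeffs-index c i = trans (cong fromFin (Fin.finToFun-funToFin (toFin ∘ c) i)) (Inverse.strictlyInverseʳ enumeration (c i))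

  coeffs-injective : ∀ {k} {x y : Fin (q ^ k)} → coeffs {k} x ≗ coeffs y → x ≡ y
  coeffs-injective {k} {x} {y} eq = begin
    x                                ≡⟨ Fin.funToFin-finToFin {k} {q} x ⟨
    funToFin (finToFun {q} {k} x)    ≡⟨ funToFin-cong (λ i → fromFin-injective (eq i)) ⟩
    funToFin (finToFun {q} {k} y)    ≡⟨ Fin.funToFin-finToFin {k} {q} y ⟩
    y                                ∎
    where open ≡-Reasoning

  2≤q : 2 ≤ q
  2≤q = Fin.injective⇒≤ {f = f} f-injective
    where
    f : Fin 2 → Fin q
    f zero = toFin 0#
    f (suc zero) = toFin 1#
    f-injective : ∀ {i j} → f i ≡ f j → i ≡ j
    f-injective {zero} {zero} _ = refl
    f-injective {zero} {suc zero} eq = contradiction (toFin-injective eq) 0≢1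
    f-injective {suc zero} {zero} eq = contradiction (sym (toFin-injective eq)) 0≢1
    f-injective {suc zero} {suc zero} _ = refl

  -- Taking coordinates in w embeds the q ^ m combinations of b into the q ^ k combinations of w.
  independent-in-span⇒≤ : ∀ {m k} (b : Fin m → V) (w : Fin k → V) →
    Independent b → (∀ c → InSpan w (lc b c)) → m ≤ k
  independent-in-span⇒≤ {m} {k} b w indep inSpan =
    ℕ.≮⇒≥ λ k<m → ℕ.<⇒≱ (ℕ.^-monoʳ-< q 2≤q k<m) (Fin.injective⇒≤ {f = ι} ι-injective)
    where
    coords : (Fin m → K) → Fin k → K
    coords c = proj₁ (inSpan c)
    ι : Fin (q ^ m) → Fin (q ^ k)
    ι = index ∘ coords ∘ coeffs {m}
    ι-injective : ∀ {x y} → ι x ≡ ι y → x ≡ y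
    ι-injective {x} {y} ιx≡ιy = coeffs-injective {m} (Independent⇒lc-injective indep (coeffs x) (coeffs y) bx≈by)
      where
      same-coords : coords (coeffs x) ≗ coords (coeffs y)
      same-coords i = trans (sym (coeffs-index _ i)) (trans (cong (λ z → coeffs z i) ιx≡ιy) (coeffs-index _ i))
      bx≈by : lc b (coeffs x) ≈ lc b (coeffs y)
      bx≈by = ≈-trans (proj₂ (inSpan (coeffs x)))
        (≈-trans (lc-cong (λ _ → ≈-refl) same-coords) (≈-sym (proj₂ (inSpan (coeffs y)))))

  _≟ₖ_ : (x y : K) → Dec (x ≡ y)
  x ≟ₖ y with toFin x Fin.≟ toFin y
  ... | yes eq = yes (toFin-injective eq)
  ... | no neq = no (neq ∘ cong toFin)

  _≟ᵥ_ : (u v : V) → Dec (u ≈ v)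
  u ≟ᵥ v = Fin.all? (λ i → u i ≟ₖ v i)

  InSpan? : ∀ {k} (b : Fin k → V) v → Dec (InSpan b v)
  InSpan? {k} b v with Fin.any? (λ x → v ≟ᵥ lc b (coeffs {k} x))
  ... | yes (x , v≈) = yes (coeffs x , v≈)
  ... | no ¬any = no λ (c , v≈) → ¬any (index c , ≈-trans v≈ (lc-cong (λ _ → ≈-refl) (sym ∘ coeffs-index c)))

  Independent-resp : ∀ {k} {b b' : Fin k → V} → (∀ i → b i ≈ b' i) → Independent b → Independent b'
  Independent-resp b≈b' indep c b'c≈0 = indep c (≈-trans (lc-cong b≈b' (λ _ → refl)) b'c≈0)

  InSpan-resp-family : ∀ {k} {b b' : Fin k → V} {v} → (∀ i → b i ≈ b' i) → InSpan b v → InSpan b' v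
  InSpan-resp-family b≈b' (c , v≈bc) = c , ≈-trans v≈bc (lc-cong b≈b' (λ _ → refl))

  Independent-∷ : ∀ {k} (b : Fin k → V) x → Independent b → ¬ InSpan b x → Independent (x ∷ b)
  Independent-∷ b x indep x∉ c xb≈0 with c zero ≟ₖ 0#
  ... | yes c₀≡0 = λ { zero → c₀≡0 ; (suc i) → indep (c ∘ suc) tail≈0 i }
    where
    tail≈0 : lc b (c ∘ suc) ≈ 0ᵥ
    tail≈0 j = begin
      lc b (c ∘ suc) j                       ≡⟨ +-identityˡ _ ⟨
      0# + lc b (c ∘ suc) j                  ≡⟨ cong (_+ lc b (c ∘ suc) j) (zeroˡ (x j)) ⟨
      0# * x j + lc b (c ∘ suc) j            ≡⟨ cong (λ a → a * x j + lc b (c ∘ suc) j) c₀≡0 ⟨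
      c zero * x j + lc b (c ∘ suc) j        ≡⟨ xb≈0 j ⟩
      0#                                     ∎
      where open ≡-Reasoning
  ... | no c₀≢0 = contradiction ((λ i → - (y * c (suc i))) , x≈) x∉
    where
    y : K
    y = proj₁ (inverse (c zero) c₀≢0)
    L : V
    L = lc b (c ∘ suc)
    -- c₀ x + L = 0, hence x = - y L with y = c₀⁻¹.
    x≈ : x ≈ lc b (λ i → - (y * c (suc i)))
    x≈ j = sym (begin
      lc b (λ i → - (y * c (suc i))) j  ≡⟨ lc-neg b (λ i → y * c (suc i)) j ⟩
      - lc b (λ i → y * c (suc i)) j    ≡⟨ cong -_ (lc-· b y (c ∘ suc) j) ⟩
      - (y * L j)                       ≡⟨ cong (λ z → - (y * z)) (inverseʳ-unique _ _ (xb≈0 j)) ⟩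
      - (y * - (c zero * x j))          ≡⟨ cong -_ (-‿distribʳ-* y (c zero * x j)) ⟨
      - - (y * (c zero * x j))          ≡⟨ ⁻¹-involutive _ ⟩
      y * (c zero * x j)                ≡⟨ trans (sym (*-assoc y (c zero) (x j))) (cong (_* x j) (*-comm y (c zero))) ⟩
      c zero * y * x j                  ≡⟨ cong (_* x j) (proj₂ (inverse (c zero) c₀≢0)) ⟩
      1# * x j                          ≡⟨ *-identityˡ (x j) ⟩
      x j                               ∎)
      where open ≡-Reasoning

  ∷-++ : ∀ {m k} x (u : Fin m → V) (w : Fin k → V) i → ((x ∷ u) ++ w) i ≈ (x ∷ (u ++ w)) i
  ∷-++ x u w zero j = refl
  ∷-++ x u w (suc i) j = cong (λ v → v j) (tail-++ (x ∷ u) w i)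

  InSpan-∷ : ∀ {k} x (b : Fin k → V) {v} → InSpan b v → InSpan (x ∷ b) v
  InSpan-∷ x b (c , v≈bc) = (0# ∷ c) , λ j → trans (v≈bc j) (sym (trans (cong (_+ lc b c j) (zeroˡ (x j))) (+-identityˡ _)))

  -- Greedy extension: scan the candidates, keeping each one in D that is not yet spanned.
  extend : (D : V → Set) → (∀ v → Dec (D v)) → ∀ {L} (cand : Fin L → V) {i} (w : Fin i → V) {m} (u : Fin m → V) →
    Independent (u ++ w) → (∀ j → D (u j)) →
    Σ ℕ λ m' → Σ (Fin m' → V) λ u' → Independent (u' ++ w) × (∀ j → D (u' j)) ×
      (∀ {v} → InSpan (u ++ w) v → InSpan (u' ++ w) v) × (∀ l → D (cand l) → InSpan (u' ++ w) (cand l))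
  extend D D? {zero} cand w u indep u∈D = _ , u , indep , u∈D , id , λ ()
  extend D D? {suc L} cand w u indep u∈D with D? (cand zero) | InSpan? (u ++ w) (cand zero)
  ... | yes c₀∈D | no c₀∉span =
    let (m' , u' , indep' , u'∈D , mono , spans) =
          extend D D? (cand ∘ suc) w (cand zero ∷ u)
            (Independent-resp (λ i → ≈-sym (∷-++ (cand zero) u w i)) (Independent-∷ (u ++ w) (cand zero) indep c₀∉span))
            (λ { zero → c₀∈D ; (suc j) → u∈D j })
        grow : ∀ {v} → InSpan (u ++ w) v → InSpan ((cand zero ∷ u) ++ w) v
        grow = InSpan-resp-family (λ i → ≈-sym (∷-++ (cand zero) u w i)) ∘ InSpan-∷ (cand zero) (u ++ w)
    in m' , u' , indep' , u'∈D , mono ∘ grow ,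
       λ { zero _ → mono (InSpan-resp-family (λ i → ≈-sym (∷-++ (cand zero) u w i))
                                               (InSpan-self (cand zero ∷ (u ++ w)) zero))
         ; (suc l) → spans l }
  ... | yes _ | yes c₀∈span =
    let (m' , u' , indep' , u'∈D , mono , spans) = extend D D? (cand ∘ suc) w u indep u∈D
    in m' , u' , indep' , u'∈D , mono , λ { zero _ → mono c₀∈span ; (suc l) → spans l }
  ... | no c₀∉D | _ =
    let (m' , u' , indep' , u'∈D , mono , spans) = extend D D? (cand ∘ suc) w u indep u∈D
    in m' , u' , indep' , u'∈D , mono , λ { zero c₀∈D → contradiction c₀∈D c₀∉D ; (suc l) → spans l }

  extend-independent : (D : V → Set) → (∀ v → Dec (D v)) → ∀ {L} (cand : Fin L → V) {i} (w : Fin i → V) →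
    Independent w → Σ ℕ λ m → Σ (Fin m → V) λ u →
      Independent (u ++ w) × (∀ j → D (u j)) × (∀ l → D (cand l) → InSpan (u ++ w) (cand l))
  extend-independent D D? cand w indep =
    let (m , u , indep' , u∈D , _ , spans) = extend D D? cand w {0} (λ ()) indep (λ ())
    in m , u , indep' , u∈D , spans

  HasDim-≤ : ∀ {P Q : V → Set} {m k} → HasDim 𝔽 n P m → HasDim 𝔽 n Q k → (∀ v → P v → Q v) → m ≤ k
  HasDim-≤ (b , indep , b∈P , _) (w , _ , _ , spanQ) P⊆Q =
    independent-in-span⇒≤ b w indep (λ c → spanQ _ (P⊆Q _ (b∈P c)))

  HasDim-unique : ∀ {P Q : V → Set} {m k} → HasDim 𝔽 n P m → HasDim 𝔽 n Q k → SameP 𝔽 n P Q → m ≡ k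
  HasDim-unique dimP dimQ P≡Q =
    ℕ.≤-antisym (HasDim-≤ dimP dimQ (proj₁ ∘ P≡Q)) (HasDim-≤ dimQ dimP (proj₂ ∘ P≡Q))

  HasDim-resp : ∀ {P Q : V → Set} {k} → SameP 𝔽 n P Q → HasDim 𝔽 n P k → HasDim 𝔽 n Q k
  HasDim-resp P≡Q (b , indep , b∈P , spanP) =
    b , indep , (λ c → proj₁ (P≡Q _) (b∈P c)) , (λ v v∈Q → spanP v (proj₂ (P≡Q v) v∈Q))

  e : Fin n → V
  e = idM 𝔽 n

  lc-e : ∀ c → lc e c ≈ c
  lc-e c j = trans (lc-apply e c j) (∑-δ c j)

  HasDim-⊤ : HasDim 𝔽 n (λ _ → ⊤) n
  HasDim-⊤ = e , (λ c ec≈0 i → trans (sym (lc-e c i)) (ec≈0 i)) , (λ _ → tt) , (λ v _ → v , ≈-sym (lc-e v))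

  HasDim-≤n : ∀ {P : V → Set} {m} → HasDim 𝔽 n P m → m ≤ n
  HasDim-≤n dimP = HasDim-≤ dimP HasDim-⊤ (λ _ _ → tt)

  HasDim-0⇒trivial : ∀ {P : V → Set} → HasDim 𝔽 n P 0 → ∀ v → P v → v ≈ 0ᵥ
  HasDim-0⇒trivial (_ , _ , _ , spanP) v v∈P = proj₂ (spanP v v∈P)

  trivial⇒HasDim-0 : ∀ {P : V → Set} {m} → HasDim 𝔽 n P m → (∀ v → P v → v ≈ 0ᵥ) → m ≡ 0
  trivial⇒HasDim-0 dimP trivial = ℕ.n≤0⇒n≡0 (HasDim-≤ dimP zero-dim trivial)
    where
    zero-dim : HasDim 𝔽 n (_≈ 0ᵥ) 0
    zero-dim = (λ ()) , (λ _ _ ()) , (λ _ _ → refl) , λ v v≈0 → (λ ()) , v≈0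

  mem? : (U : Subspace 𝔽 n) {k : ℕ} → HasDim 𝔽 n (mem U) k → ∀ v → Dec (mem U v)
  mem? U (b , _ , b∈U , spanU) v with InSpan? b v
  ... | yes (c , v≈bc) = yes (mem-resp U (≈-sym v≈bc) (b∈U c))
  ... | no v∉span = no (v∉span ∘ spanU v)

  HasDim-n⇒full : (U : Subspace 𝔽 n) → HasDim 𝔽 n (mem U) n → ∀ v → mem U v
  HasDim-n⇒full U (b , indep , b∈U , _) v with InSpan? b v
  ... | yes (c , v≈bc) = mem-resp U (≈-sym v≈bc) (b∈U c)
  ... | no v∉span = contradiction
    (independent-in-span⇒≤ (v ∷ b) e (Independent-∷ b v indep v∉span) (λ c → _ , ≈-sym (lc-e _))) ℕ.1+n≰n

  basis∈ : (U : Subspace 𝔽 n) {k : ℕ} {b : Fin k → V} → IsBasis 𝔽 n (mem U) b → ∀ j → mem U (b j)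
  basis∈ U {b = b} (_ , b∈U , _) j = mem-resp U (lc-δ b j) (b∈U (λ l → δ l j))

  IsBasis-++ : (U : Subspace 𝔽 n) {m i : ℕ} (u : Fin m → V) (w : Fin i → V) → Independent (u ++ w) →
    (∀ j → mem U (u j)) → (∀ j → mem U (w j)) → (∀ v → mem U v → InSpan (u ++ w) v) → IsBasis 𝔽 n (mem U) (u ++ w)
  IsBasis-++ U u w indep u∈U w∈U spans = indep , (λ c → mem-lc U (u ++ w) c (All-++ (mem U) u∈U w∈U)) , spans

  decidable⇒HasDim : (U : Subspace 𝔽 n) → (∀ v → Dec (mem U v)) → Σ ℕ (HasDim 𝔽 n (mem U))
  decidable⇒HasDim U mem?U =
    let (m , u , indep , u∈U , spans) = extend-independent (mem U) mem?U (coeffs {n}) (λ ()) (λ _ _ ())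
    in ℕ._+_ m 0 , u ++ (λ ()) , IsBasis-++ U u (λ ()) indep u∈U (λ ())
         (λ v v∈U → InSpan-resp (coeffs-index v) (spans (index v) (mem-resp U (sym ∘ coeffs-index v) v∈U)))

  extend-to-basis : (U : Subspace 𝔽 n) {k i : ℕ} → HasDim 𝔽 n (mem U) k → (w : Fin i → V) → Independent w →
    (∀ j → mem U (w j)) → Σ ℕ λ m → Σ (Fin m → V) λ u →
      IsBasis 𝔽 n (mem U) (u ++ w) × (∀ j → mem U (u j)) × ℕ._+_ m i ≡ k
  extend-to-basis U dimU@(b , _ , _ , spanU) w indep w∈U =
    let (m , u , indep' , u∈U , b∈span) = extend-independent (mem U) (mem? U dimU) b w indep
        spans : ∀ v → mem U v → InSpan (u ++ w) v
        spans v v∈U = let (c , v≈bc) = spanU v v∈U in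
          InSpan-resp (≈-sym v≈bc) (mem-lc (span (u ++ w)) b c (λ l → b∈span l (basis∈ U (proj₂ dimU) l)))
        basis : IsBasis 𝔽 n (mem U) (u ++ w)
        basis = IsBasis-++ U u w indep' u∈U w∈U spans
    in m , u , basis , u∈U , HasDim-unique (u ++ w , basis) dimU SameP-refl

  lc-split : ∀ {m k} (u : Fin m → V) (w : Fin k → V) c → lc (u ++ w) c ≈ lc u (take m c) +ᵥ lc w (drop m c)
  lc-split {m} u w c = ≈-trans (lc-cong (λ _ → ≈-refl) (sym ∘ take-++-drop m c)) (lc-++ u w (take m c) (drop m c))

  infixl 7 _∩ₛ_
  _∩ₛ_ : Subspace 𝔽 n → Subspace 𝔽 n → Subspace 𝔽 n
  U ∩ₛ W = record
    { mem = capP 𝔽 n U W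
    ; mem-resp = λ u≈v (u∈U , u∈W) → mem-resp U u≈v u∈U , mem-resp W u≈v u∈W
    ; mem-0 = mem-0 U , mem-0 W
    ; mem-+ = λ (u∈U , u∈W) (v∈U , v∈W) → mem-+ U u∈U v∈U , mem-+ W u∈W v∈W
    ; mem-· = λ c (v∈U , v∈W) → mem-· U c v∈U , mem-· W c v∈W
    }

  infixl 6 _+ₛ_
  _+ₛ_ : Subspace 𝔽 n → Subspace 𝔽 n → Subspace 𝔽 n
  U +ₛ W = record
    { mem = sumP 𝔽 n U W
    ; mem-resp = λ x≈y (u , w , u∈U , w∈W , x≈u+w) → u , w , u∈U , w∈W , ≈-trans (≈-sym x≈y) x≈u+w
    ; mem-0 = 0ᵥ , 0ᵥ , mem-0 U , mem-0 W , (λ _ → sym (+-identityˡ 0#))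
    ; mem-+ = λ (u , w , u∈U , w∈W , x≈) (u' , w' , u'∈U , w'∈W , x'≈) →
        u +ᵥ u' , w +ᵥ w' , mem-+ U u∈U u'∈U , mem-+ W w∈W w'∈W ,
        (λ j → trans (cong₂ _+_ (x≈ j) (x'≈ j))
          (solve 4 (λ a b c d → a :+ b :+ (c :+ d) ⊜ a :+ c :+ (b :+ d)) refl (u j) (w j) (u' j) (w' j)))
    ; mem-· = λ c (u , w , u∈U , w∈W , x≈) → c ·ᵥ u , c ·ᵥ w , mem-· U c u∈U , mem-· W c w∈W ,
        (λ j → trans (cong (c *_) (x≈ j)) (distribˡ c (u j) (w j)))
    }

  ∈ˡ-+ₛ : (U W : Subspace 𝔽 n) → ∀ {x} → mem U x → mem (U +ₛ W) x
  ∈ˡ-+ₛ U W {x} x∈U = x , 0ᵥ , x∈U , mem-0 W , λ j → sym (+-identityʳ (x j))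

  ∈ʳ-+ₛ : (U W : Subspace 𝔽 n) → ∀ {x} → mem W x → mem (U +ₛ W) x
  ∈ʳ-+ₛ U W {x} x∈W = 0ᵥ , x , mem-0 U , x∈W , λ j → sym (+-identityˡ (x j))

  ∩ₛ⊆+ₛ : (U W : Subspace 𝔽 n) → ∀ v → mem (U ∩ₛ W) v → mem (U +ₛ W) v
  ∩ₛ⊆+ₛ U W v (v∈U , _) = ∈ˡ-+ₛ U W v∈U

  mem-∩ₛ? : (U W : Subspace 𝔽 n) {k₁ k₂ : ℕ} → HasDim 𝔽 n (mem U) k₁ → HasDim 𝔽 n (mem W) k₂ →
    ∀ v → Dec (mem (U ∩ₛ W) v)
  mem-∩ₛ? U W dimU dimW v with mem? U dimU v | mem? W dimW v
  ... | yes v∈U | yes v∈W = yes (v∈U , v∈W)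
  ... | no v∉U | _ = no (v∉U ∘ proj₁)
  ... | _ | no v∉W = no (v∉W ∘ proj₂)

  mem-+ₛ? : (U W : Subspace 𝔽 n) {k₁ k₂ : ℕ} → HasDim 𝔽 n (mem U) k₁ → HasDim 𝔽 n (mem W) k₂ →
    ∀ v → Dec (mem (U +ₛ W) v)
  mem-+ₛ? U W {k₁} (bU , _ , bU∈U , spanU) (bW , _ , bW∈W , spanW) v with InSpan? (bU ++ bW) v
  ... | yes (c , v≈) = yes (lc bU (take k₁ c) , lc bW (drop k₁ c) , bU∈U _ , bW∈W _ , ≈-trans v≈ (lc-split bU bW c))
  ... | no v∉span = no λ (u , w , u∈U , w∈W , v≈u+w) →
          let (c₁ , u≈) = spanU u u∈U
              (c₂ , w≈) = spanW w w∈W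
          in v∉span (c₁ ++ c₂ , ≈-trans v≈u+w (≈-trans (λ j → cong₂ _+_ (u≈ j) (w≈ j)) (≈-sym (lc-++ bU bW c₁ c₂))))

  module _ (U W : Subspace 𝔽 n) {m₁ m₂ i : ℕ} (u : Fin m₁ → V) (v : Fin m₂ → V) (w : Fin i → V)
    (basisU : IsBasis 𝔽 n (mem U) (u ++ w)) (basisW : IsBasis 𝔽 n (mem W) (v ++ w))
    (u∈U : ∀ j → mem U (u j)) (v∈W : ∀ j → mem W (v j)) (w∈U∩W : ∀ j → mem (U ∩ₛ W) (w j))
    (spanU∩W : ∀ x → mem (U ∩ₛ W) x → InSpan w x) where

    -- Split c = a ++ b ++ d.  Then lc u a + lc w d lies in U and equals - lc v b ∈ W,
    -- so it is spanned by w alone: independence of u ++ w kills a, then that of v ++ w kills b and d.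
    Independent-+ₛ : Independent (u ++ (v ++ w))
    Independent-+ₛ c G≈0 = take-drop-≗ m₁ a≗0 (take-drop-≗ m₂ b≗0 d≗0)
      where
      a : Fin m₁ → K
      a = take m₁ c
      r : Fin (m₂ ℕ.+ i) → K
      r = drop m₁ c
      b : Fin m₂ → K
      b = take m₂ r
      d : Fin i → K
      d = drop m₂ r
      A B D : V
      A = lc u a
      B = lc v b
      D = lc w d
      A+B+D≈0 : A +ᵥ (B +ᵥ D) ≈ 0ᵥ
      A+B+D≈0 j = trans (cong (A j +_) (sym (lc-split v w r j))) (trans (sym (lc-split u (v ++ w) c j)) (G≈0 j))
      X : V
      X = lc (u ++ w) (a ++ d)
      X≈-B : ∀ j → X j ≡ - B j
      X≈-B j = trans (lc-++ u w a d j) (inverseʳ-unique (B j) (A j + D j)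
        (trans (solve 3 (λ a b d → b :+ (a :+ d) ⊜ a :+ (b :+ d)) refl (A j) (B j) (D j)) (A+B+D≈0 j)))
      X∈W : mem W X
      X∈W = mem-resp W (λ j → trans (lc-neg v b j) (sym (X≈-B j))) (mem-lc W v (λ j → - b j) v∈W)
      X∈U∩W : mem (U ∩ₛ W) X
      X∈U∩W = proj₁ (proj₂ basisU) (a ++ d) , X∈W
      coeffs-w : Fin i → K
      coeffs-w = proj₁ (spanU∩W X X∈U∩W)
      X≈w-part : X ≈ lc (u ++ w) ((λ _ → 0#) ++ coeffs-w)
      X≈w-part = ≈-trans (proj₂ (spanU∩W X X∈U∩W))
        (≈-sym (≈-trans (lc-++ u w _ coeffs-w) (λ j → trans (cong (_+ lc w coeffs-w j) (lc-0 u j)) (+-identityˡ _))))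
      a≗0 : a ≗ (λ _ → 0#)
      a≗0 = ++-injectiveˡ a (λ _ → 0#) (Independent⇒lc-injective (proj₁ basisU) _ _ X≈w-part)
      v++w≈0 : lc (v ++ w) (b ++ d) ≈ 0ᵥ
      v++w≈0 j = begin
        lc (v ++ w) (b ++ d) j      ≡⟨ lc-++ v w b d j ⟩
        B j + D j                   ≡⟨ +-identityˡ _ ⟨
        0# + (B j + D j)            ≡⟨ cong (_+ (B j + D j)) (trans (lc-cong (λ _ → ≈-refl) a≗0 j) (lc-0 u j)) ⟨
        A j + (B j + D j)           ≡⟨ A+B+D≈0 j ⟩
        0#                          ∎
        where open ≡-Reasoning
      b≗0 : b ≗ (λ _ → 0#)
      b≗0 j = trans (sym (lookup-++ˡ b d j)) (proj₁ basisW (b ++ d) v++w≈0 _)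
      d≗0 : d ≗ (λ _ → 0#)
      d≗0 j = trans (sym (lookup-++ʳ b d j)) (proj₁ basisW (b ++ d) v++w≈0 _)

    spans-+ₛ : ∀ x → mem (U +ₛ W) x → InSpan (u ++ (v ++ w)) x
    spans-+ₛ x (y , z , y∈U , z∈W , x≈y+z) = take m₁ c₁ ++ (take m₂ c₂ ++ (λ j → d₁ j + d₂ j)) , x≈
      where
      c₁ : Fin (m₁ ℕ.+ i) → K
      c₁ = proj₁ (proj₂ (proj₂ basisU) y y∈U)
      c₂ : Fin (m₂ ℕ.+ i) → K
      c₂ = proj₁ (proj₂ (proj₂ basisW) z z∈W)
      d₁ d₂ : Fin i → K
      d₁ = drop m₁ c₁
      d₂ = drop m₂ c₂
      y≈ : y ≈ lc u (take m₁ c₁) +ᵥ lc w d₁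
      y≈ = ≈-trans (proj₂ (proj₂ (proj₂ basisU) y y∈U)) (lc-split u w c₁)
      z≈ : z ≈ lc v (take m₂ c₂) +ᵥ lc w d₂
      z≈ = ≈-trans (proj₂ (proj₂ (proj₂ basisW) z z∈W)) (lc-split v w c₂)
      x≈ : x ≈ lc (u ++ (v ++ w)) _
      x≈ j = sym (begin
        lc (u ++ (v ++ w)) (take m₁ c₁ ++ (take m₂ c₂ ++ (λ j → d₁ j + d₂ j))) j
          ≡⟨ lc-++ u (v ++ w) _ _ j ⟩
        lc u (take m₁ c₁) j + lc (v ++ w) (take m₂ c₂ ++ (λ j → d₁ j + d₂ j)) j
          ≡⟨ cong (lc u (take m₁ c₁) j +_) (trans (lc-++ v w _ _ j) (cong (lc v (take m₂ c₂) j +_) (lc-+ w d₁ d₂ j))) ⟩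
        lc u (take m₁ c₁) j + (lc v (take m₂ c₂) j + (lc w d₁ j + lc w d₂ j))
          ≡⟨ solve 4 (λ a b c d → a :+ (b :+ (c :+ d)) ⊜ a :+ c :+ (b :+ d)) refl
               (lc u (take m₁ c₁) j) (lc v (take m₂ c₂) j) (lc w d₁ j) (lc w d₂ j) ⟩
        (lc u (take m₁ c₁) j + lc w d₁ j) + (lc v (take m₂ c₂) j + lc w d₂ j)
          ≡⟨ cong₂ _+_ (y≈ j) (z≈ j) ⟨
        y j + z j
          ≡⟨ x≈y+z j ⟨
        x j ∎)
        where open ≡-Reasoning

    IsBasis-+ₛ : IsBasis 𝔽 n (mem (U +ₛ W)) (u ++ (v ++ w))
    IsBasis-+ₛ = IsBasis-++ (U +ₛ W) u (v ++ w) Independent-+ₛ (∈ˡ-+ₛ U W ∘ u∈U)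
      (All-++ (mem (U +ₛ W)) (∈ʳ-+ₛ U W ∘ v∈W) (∈ˡ-+ₛ U W ∘ proj₁ ∘ w∈U∩W)) spans-+ₛ

  grassmann : (U W : Subspace 𝔽 n) {k₁ k₂ s i : ℕ} → HasDim 𝔽 n (mem U) k₁ → HasDim 𝔽 n (mem W) k₂ →
    HasDim 𝔽 n (mem (U +ₛ W)) s → HasDim 𝔽 n (mem (U ∩ₛ W)) i → s ℕ.+ i ≡ k₁ ℕ.+ k₂
  grassmann U W {k₁} {k₂} {s} {i} dimU dimW dim+ (w , basis∩) =
    let (m₁ , u , basisU , u∈U , m₁+i≡k₁) = extend-to-basis U dimU w (proj₁ basis∩) (proj₁ ∘ basis∈ (U ∩ₛ W) basis∩)
        (m₂ , v , basisW , v∈W , m₂+i≡k₂) = extend-to-basis W dimW w (proj₁ basis∩) (proj₂ ∘ basis∈ (U ∩ₛ W) basis∩)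
        m₁+[m₂+i]≡s = HasDim-unique
          (_ , IsBasis-+ₛ U W u v w basisU basisW u∈U v∈W (basis∈ (U ∩ₛ W) basis∩) (proj₂ (proj₂ basis∩)))
          dim+ SameP-refl
    in begin
      s ℕ.+ i                          ≡⟨ cong (ℕ._+ i) m₁+[m₂+i]≡s ⟨
      m₁ ℕ.+ (m₂ ℕ.+ i) ℕ.+ i          ≡⟨ +-shuffle m₁ m₂ i ⟩
      (m₁ ℕ.+ i) ℕ.+ (m₂ ℕ.+ i)        ≡⟨ cong₂ ℕ._+_ m₁+i≡k₁ m₂+i≡k₂ ⟩
      k₁ ℕ.+ k₂                        ∎
    where open ≡-Reasoning

  infixl 7 _▹_
  _▹_ : V → Mat 𝔽 n → V
  _▹_ = _▸_ 𝔽 n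

  infix 4 _≈ₘ_
  _≈ₘ_ : Mat 𝔽 n → Mat 𝔽 n → Set
  _≈ₘ_ = _≋M_ 𝔽 n

  infixl 7 _⊗ₘ_
  _⊗ₘ_ : Mat 𝔽 n → Mat 𝔽 n → Mat 𝔽 n
  _⊗ₘ_ = _⊗_ 𝔽 n

  ▹-⊗ : ∀ v (A B : Mat 𝔽 n) → v ▹ (A ⊗ₘ B) ≈ v ▹ A ▹ B
  ▹-⊗ v A B j = ∑-*-∑ v A (λ m → B m j)

  ▹-idM : ∀ v → v ▹ idM 𝔽 n ≈ v
  ▹-idM v = ∑-δ v

  ▹-congˡ : ∀ {u v} (A : Mat 𝔽 n) → u ≈ v → u ▹ A ≈ v ▹ A
  ▹-congˡ A u≈v j = ∑-cong (λ i → cong (_* A i j) (u≈v i))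

  ▹-congʳ : ∀ v {A B : Mat 𝔽 n} → A ≈ₘ B → v ▹ A ≈ v ▹ B
  ▹-congʳ v A≈B j = ∑-cong (λ i → cong (v i *_) (A≈B i j))

  ▹-inverse : ∀ v {A B : Mat 𝔽 n} → A ⊗ₘ B ≈ₘ idM 𝔽 n → v ▹ A ▹ B ≈ v
  ▹-inverse v {A} {B} AB≈I = ≈-trans (≈-sym (▹-⊗ v A B)) (≈-trans (▹-congʳ v AB≈I) (▹-idM v))

  lc-▹ : ∀ {k} (b : Fin k → V) c (A : Mat 𝔽 n) → lc (λ l → b l ▹ A) c ≈ lc b c ▹ A
  lc-▹ b c A j = begin
    lc (λ l → b l ▹ A) c j                          ≡⟨ lc-apply (λ l → b l ▹ A) c j ⟩
    ∑ (λ l → c l * ∑ (λ i → b l i * A i j))          ≡⟨ ∑-*-∑ c b (λ i → A i j) ⟩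
    ∑ (λ i → ∑ (λ l → c l * b l i) * A i j)          ≡⟨ ∑-cong (λ i → cong (_* A i j) (lc-apply b c i)) ⟨
    (lc b c ▹ A) j                                   ∎
    where open ≡-Reasoning

  0ᵥ-▹ : ∀ (A : Mat 𝔽 n) → 0ᵥ ▹ A ≈ 0ᵥ
  0ᵥ-▹ A j = trans (∑-cong (λ i → zeroˡ (A i j))) (∑-0 {n})

  +ᵥ-▹ : ∀ u v (A : Mat 𝔽 n) → (u +ᵥ v) ▹ A ≈ u ▹ A +ᵥ v ▹ A
  +ᵥ-▹ u v A j = trans (∑-cong (λ i → distribʳ (A i j) (u i) (v i))) (∑-+ (λ i → u i * A i j) (λ i → v i * A i j))

  ·ᵥ-▹ : ∀ c v (A : Mat 𝔽 n) → (c ·ᵥ v) ▹ A ≈ c ·ᵥ (v ▹ A)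
  ·ᵥ-▹ c v A j = trans (∑-cong (λ i → *-assoc c (v i) (A i j))) (∑-*ˡ c (λ i → v i * A i j))

  infixl 7 _·ₛ_
  _·ₛ_ : Subspace 𝔽 n → Mat 𝔽 n → Subspace 𝔽 n
  U ·ₛ A = record
    { mem = actP 𝔽 n U A
    ; mem-resp = λ w≈w' (v , v∈U , w≈vA) → v , v∈U , ≈-trans (≈-sym w≈w') w≈vA
    ; mem-0 = 0ᵥ , mem-0 U , ≈-sym (0ᵥ-▹ A)
    ; mem-+ = λ (v , v∈U , w≈) (v' , v'∈U , w'≈) →
        v +ᵥ v' , mem-+ U v∈U v'∈U , ≈-trans (λ j → cong₂ _+_ (w≈ j) (w'≈ j)) (≈-sym (+ᵥ-▹ v v' A))
    ; mem-· = λ c (v , v∈U , w≈) → c ·ᵥ v , mem-· U c v∈U , ≈-trans (λ j → cong (c *_) (w≈ j)) (≈-sym (·ᵥ-▹ c v A))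
    }

  HasDim-·ₛ : (U : Subspace 𝔽 n) {k : ℕ} (A B : Mat 𝔽 n) → A ⊗ₘ B ≈ₘ idM 𝔽 n →
    HasDim 𝔽 n (mem U) k → HasDim 𝔽 n (mem (U ·ₛ A)) k
  HasDim-·ₛ U A B AB≈I (b , indep , b∈U , spanU) = (λ l → b l ▹ A) , indep' , bA∈UA , spanUA
    where
    indep' : Independent (λ l → b l ▹ A)
    indep' c bAc≈0 = indep c (≈-trans (≈-sym (▹-inverse (lc b c) AB≈I))
      (≈-trans (▹-congˡ B (≈-trans (≈-sym (lc-▹ b c A)) bAc≈0)) (0ᵥ-▹ B)))
    bA∈UA : ∀ c → mem (U ·ₛ A) (lc (λ l → b l ▹ A) c)
    bA∈UA c = lc b c , b∈U c , lc-▹ b c A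
    spanUA : ∀ w → mem (U ·ₛ A) w → InSpan (λ l → b l ▹ A) w
    spanUA w (v , v∈U , w≈vA) =
      let (c , v≈bc) = spanU v v∈U in c , ≈-trans w≈vA (≈-trans (▹-congˡ A v≈bc) (≈-sym (lc-▹ b c A)))

  -- The witness is A B⁻¹.
  OrbS-of-common-image : (H : Subgroup 𝔽 n) (U W X Y : Subspace 𝔽 n) (A B : Mat 𝔽 n) → elem H A → elem H B →
    SameP 𝔽 n (mem X) (actP 𝔽 n U A) → SameP 𝔽 n (mem Y) (actP 𝔽 n W B) → _≈S_ 𝔽 n X Y → OrbS 𝔽 n H U W
  OrbS-of-common-image H U W X Y A B A∈H B∈H X≡UA Y≡WB X≡Y =
    let (B⁻¹ , B⁻¹∈H , BB⁻¹≈I , _) = elem-inv H B∈H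
        to : ∀ v → mem W v → actP 𝔽 n U (A ⊗ₘ B⁻¹) v
        to v v∈W =
          let (u , u∈U , vB≈uA) = proj₁ (X≡UA (v ▹ B)) (proj₂ (X≡Y (v ▹ B)) (proj₂ (Y≡WB (v ▹ B)) (v , v∈W , ≈-refl)))
          in u , u∈U , ≈-trans (≈-sym (▹-inverse v BB⁻¹≈I)) (≈-trans (▹-congˡ B⁻¹ vB≈uA) (≈-sym (▹-⊗ u A B⁻¹)))
        from : ∀ v → actP 𝔽 n U (A ⊗ₘ B⁻¹) v → mem W v
        from v (u , u∈U , v≈uAB⁻¹) =
          let (w , w∈W , uA≈wB) = proj₁ (Y≡WB (u ▹ A)) (proj₁ (X≡Y (u ▹ A)) (proj₂ (X≡UA (u ▹ A)) (u , u∈U , ≈-refl)))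
          in mem-resp W (≈-sym (≈-trans v≈uAB⁻¹ (≈-trans (▹-⊗ u A B⁻¹)
               (≈-trans (▹-congˡ B⁻¹ uA≈wB) (▹-inverse w BB⁻¹≈I))))) w∈W
    in A ⊗ₘ B⁻¹ , elem-mul H A∈H B⁻¹∈H , λ v → to v , from v

-- From here on _+_ and _*_ are the operations of ℕ (inside LinearAlgebra they are those of 𝔽).
open import Data.Nat using (_+_; _*_)

sumℕ-cong : ∀ {k} {f g : Fin k → ℕ} → f ≗ g → sumℕ f ≡ sumℕ g
sumℕ-cong {zero} f≗g = refl
sumℕ-cong {suc k} f≗g = cong₂ _+_ (f≗g zero) (sumℕ-cong (f≗g ∘ suc))

sumℕ-mono : ∀ {k} {f g : Fin k → ℕ} → (∀ i → f i ≤ g i) → sumℕ f ≤ sumℕ g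
sumℕ-mono {zero} f≤g = z≤n
sumℕ-mono {suc k} f≤g = ℕ.+-mono-≤ (f≤g zero) (sumℕ-mono (f≤g ∘ suc))

sumℕ-mono-≗ : ∀ {k} {f g : Fin k → ℕ} → (∀ i → f i ≤ g i) → sumℕ g ≤ sumℕ f → f ≗ g
sumℕ-mono-≗ {suc k} {f} {g} f≤g Σg≤Σf i with ℕ.m≤n⇒m<n∨m≡n (f≤g zero)
... | inj₁ f₀<g₀ = contradiction Σg≤Σf (ℕ.<⇒≱ (ℕ.+-mono-<-≤ f₀<g₀ (sumℕ-mono (f≤g ∘ suc))))
... | inj₂ f₀≡g₀ with i
...   | zero = f₀≡g₀
...   | suc i = sumℕ-mono-≗ (f≤g ∘ suc) tail≤ i
  where
  tail≤ : sumℕ (g ∘ suc) ≤ sumℕ (f ∘ suc)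
  tail≤ = ℕ.+-cancelˡ-≤ (f zero) _ _ (subst (λ x → x + sumℕ (g ∘ suc) ≤ sumℕ f) (sym f₀≡g₀) Σg≤Σf)

≤-sumℕ : ∀ {k} (f : Fin k → ℕ) i → f i ≤ sumℕ f
≤-sumℕ f zero = ℕ.m≤m+n _ _
≤-sumℕ f (suc i) = ℕ.≤-trans (≤-sumℕ (f ∘ suc) i) (ℕ.m≤n+m _ _)

*-distribˡ-sumℕ : ∀ {k} c (f : Fin k → ℕ) → c * sumℕ f ≡ sumℕ (λ i → c * f i)
*-distribˡ-sumℕ {zero} c f = ℕ.*-zeroʳ c
*-distribˡ-sumℕ {suc k} c f =
  trans (ℕ.*-distribˡ-+ c (f zero) (sumℕ (f ∘ suc))) (cong (c * f zero +_) (*-distribˡ-sumℕ c (f ∘ suc)))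

-- If f i ≡ f i' with i ≢ i', some section g of f avoids i', so punching i' out of g
-- injects Fin (suc k) into Fin k.
surjective⇒injective : ∀ {k} (f : Fin k → Fin k) → (∀ j → Σ (Fin k) λ i → f i ≡ j) →
  ∀ i i' → f i ≡ f i' → i ≡ i'
surjective⇒injective {suc k} f surj i i' fi≡fi' with i Fin.≟ i'
... | yes i≡i' = i≡i'
... | no i≢i' = contradiction (Fin.injective⇒≤ h-injective) (ℕ.<-irrefl refl)
  where
  g : Fin (suc k) → Fin (suc k)
  g j with proj₁ (surj j) Fin.≟ i'
  ... | yes _ = i
  ... | no _ = proj₁ (surj j)
  f∘g : ∀ j → f (g j) ≡ j
  f∘g j with proj₁ (surj j) Fin.≟ i'
  ... | yes gj≡i' = trans fi≡fi' (trans (cong f (sym gj≡i')) (proj₂ (surj j)))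
  ... | no _ = proj₂ (surj j)
  i'≢g : ∀ j → i' ≢ g j
  i'≢g j with proj₁ (surj j) Fin.≟ i'
  ... | yes _ = i≢i' ∘ sym
  ... | no gj≢i' = gj≢i' ∘ sym
  h : Fin (suc k) → Fin k
  h j = Fin.punchOut (i'≢g j)
  h-injective : ∀ {j j'} → h j ≡ h j' → j ≡ j'
  h-injective {j} {j'} hj≡hj' =
    trans (sym (f∘g j)) (trans (cong f (Fin.punchOut-injective (i'≢g j) (i'≢g j') hj≡hj')) (f∘g j'))

HasCard-⋃ : ∀ {A : Set₁} (_≈_ : A → A → Set) {m} (S : Fin m → A → Set) (c : Fin m → ℕ) →
  (∀ j → HasCard _≈_ (S j) (c j)) →
  (∀ j j' → j ≢ j' → ∀ x y → S j x → S j' y → ¬ x ≈ y) →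
  HasCard _≈_ (λ x → Σ (Fin m) λ j → S j x) (sumℕ c)
HasCard-⋃ _≈_ {zero} S c card disjoint = (λ ()) , (λ ()) , (λ ()) , λ { x (() , _) }
HasCard-⋃ {A} _≈_ {suc m} S c card disjoint = e , e∈ , e-injective , e-onto
  where
  card₀ : HasCard _≈_ (S zero) (c zero)
  card₀ = card zero
  rest : HasCard _≈_ (λ x → Σ (Fin m) λ j → S (suc j) x) (sumℕ (c ∘ suc))
  rest = HasCard-⋃ _≈_ (S ∘ suc) (c ∘ suc) (card ∘ suc)
    (λ j j' j≢j' → disjoint (suc j) (suc j') (j≢j' ∘ Fin.suc-injective))
  e₀ : Fin (c zero) → A
  e₀ = proj₁ card₀
  eᵣ : Fin (sumℕ (c ∘ suc)) → A
  eᵣ = proj₁ rest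
  e : Fin (sumℕ c) → A
  e = e₀ ++ eᵣ
  e∈ : ∀ idx → Σ (Fin (suc m)) λ j → S j (e idx)
  e∈ idx with splitAt (c zero) idx
  ... | inj₁ i = zero , proj₁ (proj₂ card₀) i
  ... | inj₂ i = let (j , p) = proj₁ (proj₂ rest) i in suc j , p
  e-injective : ∀ idx idx' → e idx ≈ e idx' → idx ≡ idx'
  e-injective idx idx' p = trans (sym (Fin.join-splitAt (c zero) _ idx))
    (trans (cong (Fin.join (c zero) _) (split-injective (splitAt (c zero) idx) (splitAt (c zero) idx') p))
      (Fin.join-splitAt (c zero) _ idx'))
    where
    split-injective : ∀ s s' → [ e₀ , eᵣ ] s ≈ [ e₀ , eᵣ ] s' → s ≡ s'
    split-injective (inj₁ i) (inj₁ i') p = cong inj₁ (proj₁ (proj₂ (proj₂ card₀)) i i' p)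
    split-injective (inj₁ i) (inj₂ i') p =
      let (j , q) = proj₁ (proj₂ rest) i' in contradiction p (disjoint zero (suc j) (λ ()) _ _ (proj₁ (proj₂ card₀) i) q)
    split-injective (inj₂ i) (inj₁ i') p =
      let (j , q) = proj₁ (proj₂ rest) i in contradiction p (disjoint (suc j) zero (λ ()) _ _ q (proj₁ (proj₂ card₀) i'))
    split-injective (inj₂ i) (inj₂ i') p = cong inj₂ (proj₁ (proj₂ (proj₂ rest)) i i' p)
  e-onto : ∀ x → (Σ (Fin (suc m)) λ j → S j x) → Σ (Fin (sumℕ c)) λ idx → x ≈ e idx
  e-onto x (zero , x∈) = let (i , p) = proj₂ (proj₂ (proj₂ card₀)) x x∈ in
    Fin.join (c zero) _ (inj₁ i) , subst (λ s → x ≈ [ e₀ , eᵣ ] s) (sym (Fin.splitAt-join (c zero) _ (inj₁ i))) p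
  e-onto x (suc j , x∈) = let (i , p) = proj₂ (proj₂ (proj₂ rest)) x (j , x∈) in
    Fin.join (c zero) _ (inj₂ i) , subst (λ s → x ≈ [ e₀ , eᵣ ] s) (sym (Fin.splitAt-join (c zero) _ (inj₂ i))) p

least-witness : ∀ {r} {P : Fin r → Set} → Decidable P → ∀ i → P i →
  Σ (Fin r) λ a → P a × (∀ k → P k → a Fin.≤ k)
least-witness {suc r} P? i Pi with P? zero
... | yes P0 = zero , P0 , λ _ _ → z≤n
... | no ¬P0 with i
...   | zero = contradiction Pi ¬P0
...   | suc i = let (a , Pa , least) = least-witness (P? ∘ suc) i Pi in
        suc a , Pa , λ { zero Pk → contradiction Pk ¬P0 ; (suc k) Pk → s≤s (least k Pk) }

greatest-witness : ∀ {r} {P : Fin r → Set} → Decidable P → ∀ i → P i →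
  Σ (Fin r) λ a → P a × (∀ k → P k → k Fin.≤ a)
greatest-witness {suc r} P? i Pi with Fin.any? (P? ∘ suc)
... | yes (k , Psk) = let (a , Pa , greatest) = greatest-witness (P? ∘ suc) k Psk in
        suc a , Pa , λ { zero _ → z≤n ; (suc k) Pk → s≤s (greatest k Pk) }
... | no ¬Psuc with i
...   | zero = zero , Pi , λ { zero _ → z≤n ; (suc k) Pk → contradiction (k , Pk) ¬Psuc }
...   | suc i = contradiction (i , Pi) ¬Psuc

DistinctPair : ∀ {ℓ} {A : Set₁} → (A → A → Set) → (A → Set ℓ) → Set (lsuc lzero ⊔ ℓ)
DistinctPair {A = A} _≈_ S = Σ A λ x → Σ A λ y → S x × S y × ¬ x ≈ y

AllDistinctAt : ∀ {ℓ} {A : Set₁} → (A → A → Set) → (A → A → ℕ → Set) → (A → Set ℓ) → ℕ → Set (lsuc lzero ⊔ ℓ)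
AllDistinctAt _≈_ dist S D = ∀ x y → S x → S y → ¬ x ≈ y → dist x y D

module _ {ℓ} {A : Set₁} (_≈_ : A → A → Set) (dist : A → A → ℕ → Set) (S : A → Set ℓ) where

  MinDist-bound⇔ : ∀ {D} → 0 < D →
    (∀ x y → S x → S y → Σ ℕ (dist x y)) →
    (∀ {x y e e'} → dist x y e → dist x y e' → e ≡ e') →
    (∀ x y e → S x → S y → dist x y e → e ≤ D) →
    MinDist _≈_ dist S D ⇔ (DistinctPair _≈_ S × AllDistinctAt _≈_ dist S D)
  MinDist-bound⇔ {D} 0<D dist-exists dist-unique dist-≤ = mk⇔ to from
    where
    to : MinDist _≈_ dist S D → DistinctPair _≈_ S × AllDistinctAt _≈_ dist S D
    to (inj₂ (_ , D≡0)) = contradiction D≡0 (ℕ.<⇒≢ 0<D ∘ sym)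
    to (inj₁ ((x , y , x∈ , y∈ , x≉y , _) , D≤)) = (x , y , x∈ , y∈ , x≉y) , all
      where
      all : AllDistinctAt _≈_ dist S D
      all x' y' x'∈ y'∈ x'≉y' = subst (dist x' y') e≡D (proj₂ (dist-exists x' y' x'∈ y'∈))
        where
        e≡D : proj₁ (dist-exists x' y' x'∈ y'∈) ≡ D
        e≡D = ℕ.≤-antisym (dist-≤ x' y' _ x'∈ y'∈ (proj₂ (dist-exists x' y' x'∈ y'∈)))
                          (D≤ x' y' _ x'∈ y'∈ x'≉y' (proj₂ (dist-exists x' y' x'∈ y'∈)))
    from : DistinctPair _≈_ S × AllDistinctAt _≈_ dist S D → MinDist _≈_ dist S D
    from ((x , y , x∈ , y∈ , x≉y) , all) =
      inj₁ ((x , y , x∈ , y∈ , x≉y , all x y x∈ y∈ x≉y) ,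
            λ x' y' e x'∈ y'∈ x'≉y' d → ℕ.≤-reflexive (dist-unique (all x' y' x'∈ y'∈ x'≉y') d))

-- min k (n − k): half the largest possible distance between k-dimensional subspaces of 𝔽_q^n.
halfMaxDist : ℕ → ℕ → ℕ
halfMaxDist n k = if 2 * k ≤ᵇ n then k else n ∸ k

maxDist≡2*halfMaxDist : ∀ n k → (if 2 * k ≤ᵇ n then 2 * k else 2 * (n ∸ k)) ≡ 2 * halfMaxDist n k
maxDist≡2*halfMaxDist n k with 2 * k ≤ᵇ n
... | true = refl
... | false = refl

halfMaxDist-≤ : ∀ {n k} → 2 * k ≤ n → halfMaxDist n k ≡ k
halfMaxDist-≤ {n} {k} 2k≤n with 2 * k ≤ᵇ n | ℕ.≤⇒≤ᵇ 2k≤n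
... | true | _ = refl

halfMaxDist-≥ : ∀ {n k} → n ≤ 2 * k → halfMaxDist n k ≡ n ∸ k
halfMaxDist-≥ {n} {k} n≤2k with 2 * k ≤ᵇ n in eq
... | false = refl
... | true = begin
  k                ≡⟨ ℕ.m+n∸n≡m k k ⟨
  k + k ∸ k        ≡⟨ cong (_∸ k) (trans (cong (k +_) (sym (ℕ.+-identityʳ k))) 2k≡n) ⟩
  n ∸ k            ∎
  where
  open ≡-Reasoning
  2k≡n : 2 * k ≡ n
  2k≡n = ℕ.≤-antisym (ℕ.≤ᵇ⇒≤ (2 * k) n (subst T (sym eq) _)) n≤2k

halfMaxDist-greatest : ∀ {n k x} → x ≤ k → x ≤ n ∸ k → x ≤ halfMaxDist n k
halfMaxDist-greatest {n} {k} x≤k x≤n∸k with 2 * k ≤ᵇ n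
... | true = x≤k
... | false = x≤n∸k

halfMaxDist-pos : ∀ {n k} → 0 < k → k < n → 0 < halfMaxDist n k
halfMaxDist-pos {n} {k} 0<k k<n = halfMaxDist-greatest 0<k (ℕ.m<n⇒0<n∸m k<n)

-- Read s = dim (U + W), i = dim (U ∩ W) and k = dim U = dim W.
grassmann-halves : ∀ {s i k} → s + i ≡ k + k → i ≤ s →
  i ≤ k × k ≤ s × s ∸ i ≡ 2 * (k ∸ i) × k ∸ i ≡ s ∸ k
grassmann-halves {s} {i} {k} s+i≡k+k i≤s = i≤k , k≤s , s∸i≡2x , k∸i≡x
  where
  open ≡-Reasoning
  k≤s : k ≤ s
  k≤s = ℕ.≮⇒≥ λ s<k → ℕ.<-irrefl s+i≡k+k (ℕ.+-mono-< s<k (ℕ.≤-<-trans i≤s s<k))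
  i≤k : i ≤ k
  i≤k = ℕ.≮⇒≥ λ k<i → ℕ.<-irrefl (sym s+i≡k+k) (ℕ.+-mono-< (ℕ.<-≤-trans k<i i≤s) k<i)
  x : ℕ
  x = s ∸ k
  x+k≡s : x + k ≡ s
  x+k≡s = ℕ.m∸n+n≡m k≤s
  x+i≡k : x + i ≡ k
  x+i≡k = ℕ.+-cancelʳ-≡ k (x + i) k (begin
    x + i + k  ≡⟨ ℕ.+-assoc x i k ⟩
    x + (i + k) ≡⟨ cong (x +_) (ℕ.+-comm i k) ⟩
    x + (k + i) ≡⟨ ℕ.+-assoc x k i ⟨
    x + k + i  ≡⟨ cong (_+ i) x+k≡s ⟩
    s + i      ≡⟨ s+i≡k+k ⟩
    k + k      ∎)
  k∸i≡x : k ∸ i ≡ x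
  k∸i≡x = trans (cong (_∸ i) (sym x+i≡k)) (ℕ.m+n∸n≡m x i)
  s∸i≡2x : s ∸ i ≡ 2 * (k ∸ i)
  s∸i≡2x = begin
    s ∸ i               ≡⟨ cong (_∸ i) (sym x+k≡s) ⟩
    x + k ∸ i           ≡⟨ cong (λ y → x + y ∸ i) (sym x+i≡k) ⟩
    x + (x + i) ∸ i     ≡⟨ cong (_∸ i) (ℕ.+-assoc x x i) ⟨
    x + x + i ∸ i       ≡⟨ ℕ.m+n∸n≡m (x + x) i ⟩
    x + x               ≡⟨ cong (x +_) (ℕ.+-identityʳ x) ⟨
    2 * x               ≡⟨ cong (2 *_) k∸i≡x ⟨
    2 * (k ∸ i)         ∎

m≤m∸n⇒n≡0 : ∀ {m n} → n ≤ m → m ≤ m ∸ n → n ≡ 0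
m≤m∸n⇒n≡0 {m} {n} n≤m m≤m∸n = ℕ.n≤0⇒n≡0 (ℕ.+-cancelˡ-≤ m n 0 (begin
  m + n        ≤⟨ ℕ.+-monoˡ-≤ n m≤m∸n ⟩
  m ∸ n + n    ≡⟨ ℕ.m∸n+n≡m n≤m ⟩
  m            ≡⟨ ℕ.+-identityʳ m ⟨
  m + 0        ∎))
  where open ℕ.≤-Reasoning

∸-cancelʳ-≤′ : ∀ {m n o} → o ≤ m → o ≤ n → m ∸ o ≤ n ∸ o → m ≤ n
∸-cancelʳ-≤′ {m} {n} {o} o≤m o≤n m∸o≤n∸o = begin
  m            ≡⟨ ℕ.m∸n+n≡m o≤m ⟨
  m ∸ o + o    ≤⟨ ℕ.+-monoˡ-≤ o m∸o≤n∸o ⟩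
  n ∸ o + o    ≡⟨ ℕ.m∸n+n≡m o≤n ⟩
  n            ∎
  where open ℕ.≤-Reasoning

module SubspaceDistance {q : ℕ} (𝔽 : FiniteField q) (n : ℕ) where
  open LinearAlgebra 𝔽 n

  DistS-exists : (U W : Subspace 𝔽 n) {k₁ k₂ : ℕ} → HasDim 𝔽 n (mem U) k₁ → HasDim 𝔽 n (mem W) k₂ →
    Σ ℕ (DistS 𝔽 n U W)
  DistS-exists U W dimU dimW =
    let (s , dim+) = decidable⇒HasDim (U +ₛ W) (mem-+ₛ? U W dimU dimW)
        (i , dim∩) = decidable⇒HasDim (U ∩ₛ W) (mem-∩ₛ? U W dimU dimW)
    in s ∸ i , s , i , dim+ , dim∩ , refl

  DistS-unique : ∀ (U W : Subspace 𝔽 n) {d d'} → DistS 𝔽 n U W d → DistS 𝔽 n U W d' → d ≡ d'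
  DistS-unique U W (s , i , dim+ , dim∩ , d≡) (s' , i' , dim+' , dim∩' , d'≡) =
    trans d≡ (trans (cong₂ _∸_ (HasDim-unique dim+ dim+' SameP-refl) (HasDim-unique dim∩ dim∩' SameP-refl)) (sym d'≡))

  DistS-resp : ∀ (U U' W W' : Subspace 𝔽 n) {d} → _≈S_ 𝔽 n U U' → _≈S_ 𝔽 n W W' →
    DistS 𝔽 n U W d → DistS 𝔽 n U' W' d
  DistS-resp U U' W W' U≡U' W≡W' (s , i , dim+ , dim∩ , d≡) =
    s , i , HasDim-resp +≡ dim+ , HasDim-resp ∩≡ dim∩ , d≡
    where
    +≡ : SameP 𝔽 n (sumP 𝔽 n U W) (sumP 𝔽 n U' W')
    +≡ v = (λ (u , w , u∈ , w∈ , v≈) → u , w , proj₁ (U≡U' u) u∈ , proj₁ (W≡W' w) w∈ , v≈)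
         , (λ (u , w , u∈ , w∈ , v≈) → u , w , proj₂ (U≡U' u) u∈ , proj₂ (W≡W' w) w∈ , v≈)
    ∩≡ : SameP 𝔽 n (capP 𝔽 n U W) (capP 𝔽 n U' W')
    ∩≡ v = (λ (v∈U , v∈W) → proj₁ (U≡U' v) v∈U , proj₁ (W≡W' v) v∈W)
         , (λ (v∈U , v∈W) → proj₂ (U≡U' v) v∈U , proj₂ (W≡W' v) v∈W)

  module _ (U W : Subspace 𝔽 n) {k : ℕ} (dimU : HasDim 𝔽 n (mem U) k) (dimW : HasDim 𝔽 n (mem W) k) where

    private
      halves : ∀ {s i} → HasDim 𝔽 n (mem (U +ₛ W)) s → HasDim 𝔽 n (mem (U ∩ₛ W)) i →
        i ≤ k × k ≤ s × s ∸ i ≡ 2 * (k ∸ i) × k ∸ i ≡ s ∸ k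
      halves dim+ dim∩ = grassmann-halves (grassmann U W dimU dimW dim+ dim∩) (HasDim-≤ dim∩ dim+ (∩ₛ⊆+ₛ U W))

    DistS-≤ : ∀ {d} → DistS 𝔽 n U W d → d ≤ 2 * halfMaxDist n k
    DistS-≤ (s , i , dim+ , dim∩ , refl) =
      let (_ , _ , d≡2[k∸i] , k∸i≡s∸k) = halves dim+ dim∩
      in subst (_≤ 2 * halfMaxDist n k) (sym d≡2[k∸i]) (ℕ.*-monoʳ-≤ 2 (halfMaxDist-greatest (ℕ.m∸n≤m k i)
           (subst (_≤ n ∸ k) (sym k∸i≡s∸k) (ℕ.∸-monoˡ-≤ k (HasDim-≤n dim+)))))

    DistS-≥⇒∩ₛ-trivial : ∀ {d} → DistS 𝔽 n U W d → 2 * k ≤ d → ∀ v → mem (U ∩ₛ W) v → v ≈ 0ᵥ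
    DistS-≥⇒∩ₛ-trivial (s , i , dim+ , dim∩ , refl) 2k≤d =
      let (i≤k , _ , d≡2[k∸i] , _) = halves dim+ dim∩
          i≡0 = m≤m∸n⇒n≡0 i≤k (ℕ.*-cancelˡ-≤ 2 (subst (2 * k ≤_) d≡2[k∸i] 2k≤d))
      in HasDim-0⇒trivial (subst (HasDim 𝔽 n (mem (U ∩ₛ W))) i≡0 dim∩)

    ∩ₛ-trivial⇒DistS : (∀ v → mem (U ∩ₛ W) v → v ≈ 0ᵥ) → DistS 𝔽 n U W (2 * k)
    ∩ₛ-trivial⇒DistS trivial =
      let (_ , s , i , dim+ , dim∩ , _) = DistS-exists U W dimU dimW
          (_ , _ , d≡2[k∸i] , _) = halves dim+ dim∩
          i≡0 = trivial⇒HasDim-0 dim∩ trivial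
      in s , i , dim+ , dim∩ , sym (trans d≡2[k∸i] (cong (λ x → 2 * (k ∸ x)) i≡0))

    DistS-≥⇒+ₛ-full : ∀ {d} → DistS 𝔽 n U W d → 2 * (n ∸ k) ≤ d → ∀ v → mem (U +ₛ W) v
    DistS-≥⇒+ₛ-full (s , i , dim+ , dim∩ , refl) le =
      let (_ , k≤s , d≡2[k∸i] , k∸i≡s∸k) = halves dim+ dim∩
          s≤n = HasDim-≤n dim+
          n∸k≤s∸k = ℕ.*-cancelˡ-≤ 2 (subst (2 * (n ∸ k) ≤_) (trans d≡2[k∸i] (cong (2 *_) k∸i≡s∸k)) le)
          s≡n = ℕ.≤-antisym s≤n (∸-cancelʳ-≤′ (ℕ.≤-trans k≤s s≤n) k≤s n∸k≤s∸k)
      in HasDim-n⇒full (U +ₛ W) (subst (HasDim 𝔽 n (mem (U +ₛ W))) s≡n dim+)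

    +ₛ-full⇒DistS : (∀ v → mem (U +ₛ W) v) → DistS 𝔽 n U W (2 * (n ∸ k))
    +ₛ-full⇒DistS full =
      let (_ , s , i , dim+ , dim∩ , _) = DistS-exists U W dimU dimW
          (_ , _ , d≡2[k∸i] , k∸i≡s∸k) = halves dim+ dim∩
          s≡n = HasDim-unique dim+ HasDim-⊤ (λ v → _ , λ _ → full v)
      in s , i , dim+ , dim∩ , sym (trans d≡2[k∸i] (cong (2 *_) (trans k∸i≡s∸k (cong (_∸ k) s≡n))))

module Flags {q : ℕ} (𝔽 : FiniteField q) (n : ℕ) {r : ℕ} (t : Fin r → ℕ) where
  open LinearAlgebra 𝔽 n
  open SubspaceDistance 𝔽 n

  act : (H : Subgroup 𝔽 n) (F : Flag 𝔽 n t) {A : Mat 𝔽 n} → elem H A → Flag 𝔽 n t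
  act H F {A} A∈H = record
    { sub = λ i → sub F i ·ₛ A
    ; sub-dim = λ i → let (A⁻¹ , _ , AA⁻¹≈I , _) = elem-inv H A∈H in HasDim-·ₛ (sub F i) A A⁻¹ AA⁻¹≈I (sub-dim F i)
    ; sub-nested = λ i j i≤j v (u , u∈Fi , v≈uA) → u , sub-nested F i j i≤j u u∈Fi , v≈uA
    }

  act∈OrbF : (H : Subgroup 𝔽 n) (F : Flag 𝔽 n t) {A : Mat 𝔽 n} (A∈H : elem H A) → OrbF 𝔽 n t H F (act H F A∈H)
  act∈OrbF H F {A} A∈H = A , A∈H , λ _ → SameP-refl

  -- π sends the index of a flag to the index of its c-th subspace; it is onto, hence injective.
  Disjoint⇒proj-injective : (C : Flag 𝔽 n t → Set) → IsDisjoint 𝔽 n t C → ∀ c F F' → C F → C F' →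
    _≈S_ 𝔽 n (sub F c) (sub F' c) → _≈F_ 𝔽 n t F F'
  Disjoint⇒proj-injective C (k , (f , f∈C , _ , f-onto) , proj-card) c F F' F∈C F'∈C Fc≡F'c =
    λ i → SameP-trans (proj₂ iF i) (SameP-trans (fF≡fF' i) (SameP-sym (proj₂ iF' i)))
    where
    p : Fin k → Subspace 𝔽 n
    p = proj₁ (proj-card c)
    p-from : ∀ y → Proj 𝔽 n t C c (p y)
    p-from = proj₁ (proj₂ (proj-card c))
    p-injective : ∀ x y → _≈S_ 𝔽 n (p x) (p y) → x ≡ y
    p-injective = proj₁ (proj₂ (proj₂ (proj-card c)))
    p-onto : ∀ U → Proj 𝔽 n t C c U → Σ (Fin k) λ x → _≈S_ 𝔽 n U (p x)
    p-onto = proj₂ (proj₂ (proj₂ (proj-card c)))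
    π : Fin k → Fin k
    π x = proj₁ (p-onto (sub (f x) c) (f x , f∈C x , SameP-refl))
    fx≡pπx : ∀ x → _≈S_ 𝔽 n (sub (f x) c) (p (π x))
    fx≡pπx x = proj₂ (p-onto (sub (f x) c) (f x , f∈C x , SameP-refl))
    π-onto : ∀ y → Σ (Fin k) λ x → π x ≡ y
    π-onto y = let (G , G∈C , py≡Gc) = p-from y
                   (x , G≡fx) = f-onto G G∈C
               in x , sym (p-injective y (π x) (SameP-trans py≡Gc (SameP-trans (G≡fx c) (fx≡pπx x))))
    iF : Σ (Fin k) λ x → _≈F_ 𝔽 n t F (f x)
    iF = f-onto F F∈C
    iF' : Σ (Fin k) λ x → _≈F_ 𝔽 n t F' (f x)
    iF' = f-onto F' F'∈C
    iF≡iF' : proj₁ iF ≡ proj₁ iF'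
    iF≡iF' = surjective⇒injective π π-onto _ _ (p-injective _ _
      (SameP-trans (SameP-sym (fx≡pπx _)) (SameP-trans (SameP-sym (proj₂ iF c))
        (SameP-trans Fc≡F'c (SameP-trans (proj₂ iF' c) (fx≡pπx _))))))
    fF≡fF' : _≈F_ 𝔽 n t (f (proj₁ iF)) (f (proj₁ iF'))
    fF≡fF' = subst (λ x → _≈F_ 𝔽 n t (f (proj₁ iF)) (f x)) iF≡iF' (λ i → SameP-refl)

  DistF-exists : (F F' : Flag 𝔽 n t) → Σ ℕ (DistF 𝔽 n t F F')
  DistF-exists F F' = sumℕ ds , ds , (λ i → proj₂ (dist i)) , refl
    where
    dist : ∀ i → Σ ℕ (DistS 𝔽 n (sub F i) (sub F' i))
    dist i = DistS-exists (sub F i) (sub F' i) (sub-dim F i) (sub-dim F' i)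
    ds : Fin r → ℕ
    ds i = proj₁ (dist i)

  DistF-unique : ∀ F F' {d d'} → DistF 𝔽 n t F F' d → DistF 𝔽 n t F F' d' → d ≡ d'
  DistF-unique F F' (ds , dist , d≡) (ds' , dist' , d'≡) =
    trans d≡ (trans (sumℕ-cong (λ i → DistS-unique (sub F i) (sub F' i) (dist i) (dist' i))) (sym d'≡))

  maxDistF : ℕ
  maxDistF = 2 * sumℕ (halfMaxDist n ∘ t)

  DistF-≤ : ∀ F F' {d} → DistF 𝔽 n t F F' d → d ≤ maxDistF
  DistF-≤ F F' (ds , dist , refl) = subst (sumℕ ds ≤_) (sym (*-distribˡ-sumℕ 2 (halfMaxDist n ∘ t)))
    (sumℕ-mono λ i → DistS-≤ (sub F i) (sub F' i) (sub-dim F i) (sub-dim F' i) (dist i))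

  DistF-max⇔ : (F F' : Flag 𝔽 n t) →
    DistF 𝔽 n t F F' maxDistF ⇔ (∀ i → DistS 𝔽 n (sub F i) (sub F' i) (2 * halfMaxDist n (t i)))
  DistF-max⇔ F F' = mk⇔ to (λ dist → _ , dist , *-distribˡ-sumℕ 2 (halfMaxDist n ∘ t))
    where
    to : DistF 𝔽 n t F F' maxDistF → ∀ i → DistS 𝔽 n (sub F i) (sub F' i) (2 * halfMaxDist n (t i))
    to (ds , dist , max≡Σds) i = subst (DistS 𝔽 n (sub F i) (sub F' i)) (ds≗max i) (dist i)
      where
      ds≗max : ds ≗ λ i → 2 * halfMaxDist n (t i)
      ds≗max = sumℕ-mono-≗ (λ i → DistS-≤ (sub F i) (sub F' i) (sub-dim F i) (sub-dim F' i) (dist i))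
        (ℕ.≤-reflexive (trans (sym (*-distribˡ-sumℕ 2 (halfMaxDist n ∘ t))) max≡Σds))

  -- F_i ∩ F'_i ⊆ F_a ∩ F'_a = 0.
  DistS-max-below : ∀ {i a} → i Fin.≤ a → (F F' : Flag 𝔽 n t) →
    DistS 𝔽 n (sub F a) (sub F' a) (2 * t a) → DistS 𝔽 n (sub F i) (sub F' i) (2 * t i)
  DistS-max-below {i} {a} i≤a F F' dist-a = ∩ₛ-trivial⇒DistS (sub F i) (sub F' i) (sub-dim F i) (sub-dim F' i)
    λ v (v∈Fi , v∈F'i) → DistS-≥⇒∩ₛ-trivial (sub F a) (sub F' a) (sub-dim F a) (sub-dim F' a) dist-a ℕ.≤-refl v
      (sub-nested F i a i≤a v v∈Fi , sub-nested F' i a i≤a v v∈F'i)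

  -- F_i + F'_i ⊇ F_b + F'_b = 𝔽_q^n.
  DistS-max-above : ∀ {b i} → b Fin.≤ i → (F F' : Flag 𝔽 n t) →
    DistS 𝔽 n (sub F b) (sub F' b) (2 * (n ∸ t b)) → DistS 𝔽 n (sub F i) (sub F' i) (2 * (n ∸ t i))
  DistS-max-above {b} {i} b≤i F F' dist-b = +ₛ-full⇒DistS (sub F i) (sub F' i) (sub-dim F i) (sub-dim F' i)
    λ v → let (u , u' , u∈Fb , u'∈F'b , v≈) =
                DistS-≥⇒+ₛ-full (sub F b) (sub F' b) (sub-dim F b) (sub-dim F' b) dist-b ℕ.≤-refl v
          in u , u' , sub-nested F b i b≤i u u∈Fb , sub-nested F' b i b≤i u' u'∈F'b , v≈

a-or-b : ∀ n {r} (t : Fin r → ℕ) i →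
  (2 * t i ≤ n × Σ (Fin r) (IsA n t)) ⊎ (n ≤ 2 * t i × Σ (Fin r) (IsB n t))
a-or-b n t i with 2 * t i ℕ.≤? n
... | yes 2tᵢ≤n = inj₁ (2tᵢ≤n , greatest-witness (λ k → 2 * t k ℕ.≤? n) i 2tᵢ≤n)
... | no 2tᵢ≰n = inj₂ (n≤2tᵢ , least-witness (λ k → n ℕ.≤? 2 * t k) i n≤2tᵢ)
  where
  n≤2tᵢ : n ≤ 2 * t i
  n≤2tᵢ = ℕ.<⇒≤ (ℕ.≰⇒> 2tᵢ≰n)

module UnionOfOrbits {q : ℕ} (𝔽 : FiniteField q) (n : ℕ) {r : ℕ} (t : Fin r → ℕ)
  {m : ℕ} (Fs : Fin m → Flag 𝔽 n t) (H : Subgroup 𝔽 n)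
  (disjoint : ∀ j → IsDisjoint 𝔽 n t (OrbF 𝔽 n t H (Fs j))) where
  open LinearAlgebra 𝔽 n
  open SubspaceDistance 𝔽 n
  open Flags 𝔽 n t

  C : Flag 𝔽 n t → Set
  C F = Σ (Fin m) λ j → OrbF 𝔽 n t H (Fs j) F

  Code : Fin r → Subspace 𝔽 n → Set
  Code c U = Σ (Fin m) λ j → OrbS 𝔽 n H (sub (Fs j) c) U

  SeparatedAt : Fin r → Set
  SeparatedAt c = ∀ j j' → j ≢ j' → ¬ OrbS 𝔽 n H (sub (Fs j) c) (sub (Fs j') c)

  C⇒Code : ∀ F → C F → ∀ c → Code c (sub F c)
  C⇒Code F (j , A , A∈H , F≡FjA) c = j , A , A∈H , F≡FjA c

  Code⇒C : ∀ c U → Code c U → Σ (Flag 𝔽 n t) λ F → C F × _≈S_ 𝔽 n U (sub F c)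
  Code⇒C c U (j , A , A∈H , U≡FjA) = act H (Fs j) A∈H , (j , act∈OrbF H (Fs j) A∈H) , U≡FjA

  separated-orbits : ∀ c → SeparatedAt c → ∀ {j j'} → j ≢ j' → ∀ F F' →
    OrbF 𝔽 n t H (Fs j) F → OrbF 𝔽 n t H (Fs j') F' → ¬ _≈S_ 𝔽 n (sub F c) (sub F' c)
  separated-orbits c sep {j} {j'} j≢j' F F' (A , A∈H , F≡FjA) (B , B∈H , F'≡Fj'B) Fc≡F'c =
    sep j j' j≢j' (OrbS-of-common-image H (sub (Fs j) c) (sub (Fs j') c) (sub F c) (sub F' c) A B A∈H B∈H
      (F≡FjA c) (F'≡Fj'B c) Fc≡F'c)

  separated-distinct : ∀ c → SeparatedAt c → ∀ F F' → C F → C F' →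
    ¬ _≈F_ 𝔽 n t F F' → ¬ _≈S_ 𝔽 n (sub F c) (sub F' c)
  separated-distinct c sep F F' (j , F∈Oj) (j' , F'∈Oj') F≉F' with j Fin.≟ j'
  ... | yes refl = F≉F' ∘ Disjoint⇒proj-injective (OrbF 𝔽 n t H (Fs j)) (disjoint j) c F F' F∈Oj F'∈Oj'
  ... | no j≢j' = separated-orbits c sep j≢j' F F' F∈Oj F'∈Oj'

  card-⋃ : ∀ c → SeparatedAt c → (k : Fin m → ℕ) →
    (∀ j → HasCard (_≈F_ 𝔽 n t) (OrbF 𝔽 n t H (Fs j)) (k j)) → HasCard (_≈F_ 𝔽 n t) C (sumℕ k)
  card-⋃ c sep k card = HasCard-⋃ (_≈F_ 𝔽 n t) (OrbF 𝔽 n t H ∘ Fs) k card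
    λ j j' j≢j' F F' F∈Oj F'∈Oj' F≡F' → separated-orbits c sep j≢j' F F' F∈Oj F'∈Oj' (F≡F' c)

  PairC : Set₁
  PairC = DistinctPair (_≈F_ 𝔽 n t) C

  MaxC : Set₁
  MaxC = AllDistinctAt (_≈F_ 𝔽 n t) (DistF 𝔽 n t) C maxDistF

  PairCode : Fin r → Set₁
  PairCode c = DistinctPair (_≈S_ 𝔽 n) (Code c)

  MaxCode : Fin r → Set₁
  MaxCode c = AllDistinctAt (_≈S_ 𝔽 n) (DistS 𝔽 n) (Code c) (2 * halfMaxDist n (t c))

  Optimum⇔ : IsType n t → Fin r → IsOptimum 𝔽 n t C ⇔ (PairC × MaxC)
  Optimum⇔ (0<t , t<n , _) c = MinDist-bound⇔ (_≈F_ 𝔽 n t) (DistF 𝔽 n t) C 0<max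
    (λ F F' _ _ → DistF-exists F F') (λ {F} {F'} → DistF-unique F F') (λ F F' _ _ _ → DistF-≤ F F')
    where
    0<max : 0 < maxDistF
    0<max = ℕ.<-≤-trans (halfMaxDist-pos (0<t c) (t<n c))
      (ℕ.≤-trans (≤-sumℕ (halfMaxDist n ∘ t) c) (ℕ.m≤m+n _ _))

  MaxDist⇔ : IsType n t → ∀ c → MaxDistS 𝔽 n (t c) (Code c) ⇔ (PairCode c × MaxCode c)
  MaxDist⇔ (0<t , t<n , _) c =
    subst (λ D → MinDist (_≈S_ 𝔽 n) (DistS 𝔽 n) (Code c) D ⇔ (PairCode c × MaxCode c))
      (sym (maxDist≡2*halfMaxDist n (t c)))
      (MinDist-bound⇔ (_≈S_ 𝔽 n) (DistS 𝔽 n) (Code c) 0<max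
        (λ U U' U∈ U'∈ → DistS-exists U U' (dim U U∈) (dim U' U'∈)) (λ {U} {U'} → DistS-unique U U')
        (λ U U' _ U∈ U'∈ → DistS-≤ U U' (dim U U∈) (dim U' U'∈)))
    where
    0<max : 0 < 2 * halfMaxDist n (t c)
    0<max = ℕ.<-≤-trans (halfMaxDist-pos (0<t c) (t<n c)) (ℕ.m≤m+n _ _)
    dim : ∀ U → Code c U → HasDim 𝔽 n (mem U) (t c)
    dim U U∈ = let (F , _ , U≡Fc) = Code⇒C c U U∈ in HasDim-resp (SameP-sym U≡Fc) (sub-dim F c)

  PairC⇒PairCode : ∀ c → SeparatedAt c → PairC → PairCode c
  PairC⇒PairCode c sep (F , F' , F∈ , F'∈ , F≉F') =
    sub F c , sub F' c , C⇒Code F F∈ c , C⇒Code F' F'∈ c , separated-distinct c sep F F' F∈ F'∈ F≉F'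

  PairCode⇒PairC : ∀ c → PairCode c → PairC
  PairCode⇒PairC c (U , U' , U∈ , U'∈ , U≉U') =
    let (F , F∈ , U≡Fc) = Code⇒C c U U∈
        (F' , F'∈ , U'≡F'c) = Code⇒C c U' U'∈
    in F , F' , F∈ , F'∈ , λ F≡F' → SameP-≉-resp U≡Fc U'≡F'c U≉U' (F≡F' c)

  MaxC⇒MaxCode : ∀ c → MaxC → MaxCode c
  MaxC⇒MaxCode c max U U' U∈ U'∈ U≉U' =
    let (F , F∈ , U≡Fc) = Code⇒C c U U∈
        (F' , F'∈ , U'≡F'c) = Code⇒C c U' U'∈
    in DistS-resp (sub F c) U (sub F' c) U' (SameP-sym U≡Fc) (SameP-sym U'≡F'c)
         (Equivalence.to (DistF-max⇔ F F') (max F F' F∈ F'∈ λ F≡F' → SameP-≉-resp U≡Fc U'≡F'c U≉U' (F≡F' c)) c)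

  MaxCode⇒MaxC : (∀ a → IsA n t a → SeparatedAt a × MaxCode a) → (∀ b → IsB n t b → SeparatedAt b × MaxCode b) → MaxC
  MaxCode⇒MaxC at-a at-b F F' F∈ F'∈ F≉F' = Equivalence.from (DistF-max⇔ F F') component
    where
    max-at : ∀ c → SeparatedAt c × MaxCode c → DistS 𝔽 n (sub F c) (sub F' c) (2 * halfMaxDist n (t c))
    max-at c (sep , max) =
      max (sub F c) (sub F' c) (C⇒Code F F∈ c) (C⇒Code F' F'∈ c) (separated-distinct c sep F F' F∈ F'∈ F≉F')
    component : ∀ i → DistS 𝔽 n (sub F i) (sub F' i) (2 * halfMaxDist n (t i))
    component i with a-or-b n t i
    ... | inj₁ (2tᵢ≤n , a , isA@(2tₐ≤n , greatest)) =
      subst (DistS 𝔽 n (sub F i) (sub F' i)) (cong (2 *_) (sym (halfMaxDist-≤ {n} {t i} 2tᵢ≤n)))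
        (DistS-max-below (greatest i 2tᵢ≤n) F F'
          (subst (DistS 𝔽 n (sub F a) (sub F' a)) (cong (2 *_) (halfMaxDist-≤ {n} {t a} 2tₐ≤n)) (max-at a (at-a a isA))))
    ... | inj₂ (n≤2tᵢ , b , isB@(n≤2t_b , least)) =
      subst (DistS 𝔽 n (sub F i) (sub F' i)) (cong (2 *_) (sym (halfMaxDist-≥ {n} {t i} n≤2tᵢ)))
        (DistS-max-above (least i n≤2tᵢ) F F'
          (subst (DistS 𝔽 n (sub F b) (sub F' b)) (cong (2 *_) (halfMaxDist-≥ {n} {t b} n≤2t_b)) (max-at b (at-b b isB))))

  MaxDistAt : Fin r → Set₁
  MaxDistAt c = MaxDistS 𝔽 n (t c) (Code c)

  optimum⇒maxDist : IsType n t → Fin r → (∀ a → IsA n t a → SeparatedAt a) → (∀ b → IsB n t b → SeparatedAt b) →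
    IsOptimum 𝔽 n t C → (∀ a → IsA n t a → MaxDistAt a) × (∀ b → IsB n t b → MaxDistAt b)
  optimum⇒maxDist type i sep-a sep-b optimum =
      (λ a isA → from (MaxDist⇔ type a) (PairC⇒PairCode a (sep-a a isA) pair , MaxC⇒MaxCode a max))
    , (λ b isB → from (MaxDist⇔ type b) (PairC⇒PairCode b (sep-b b isB) pair , MaxC⇒MaxCode b max))
    where
    open Equivalence using (from)
    pair : PairC
    pair = proj₁ (Equivalence.to (Optimum⇔ type i) optimum)
    max : MaxC
    max = proj₂ (Equivalence.to (Optimum⇔ type i) optimum)

  maxDist⇒optimum : IsType n t → Fin r → (∀ a → IsA n t a → SeparatedAt a) → (∀ b → IsB n t b → SeparatedAt b) →
    (∀ a → IsA n t a → MaxDistAt a) × (∀ b → IsB n t b → MaxDistAt b) → IsOptimum 𝔽 n t C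
  maxDist⇒optimum type i sep-a sep-b (max-a , max-b) = Equivalence.from (Optimum⇔ type i) (pair , max)
    where
    open Equivalence using (to)
    pair : PairC
    pair = [ (λ (_ , a , isA) → PairCode⇒PairC a (proj₁ (to (MaxDist⇔ type a) (max-a a isA))))
           , (λ (_ , b , isB) → PairCode⇒PairC b (proj₁ (to (MaxDist⇔ type b) (max-b b isB)))) ]′ (a-or-b n t i)
    max : MaxC
    max = MaxCode⇒MaxC (λ a isA → sep-a a isA , proj₂ (to (MaxDist⇔ type a) (max-a a isA)))
                       (λ b isB → sep-b b isB , proj₂ (to (MaxDist⇔ type b) (max-b b isB)))

theorem4p13 : {q : ℕ} (𝔽 : FiniteField q) (n r : ℕ) (t : Fin r → ℕ) →
    0 < r → IsType n t →
    (m : ℕ) (Fs : Fin m → Flag 𝔽 n t) (H : Subgroup 𝔽 n) →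
    (∀ j → IsDisjoint 𝔽 n t (OrbF 𝔽 n t H (Fs j))) →
    (∀ a → IsA n t a → ∀ j j' → j ≢ j' →
      ¬ OrbS 𝔽 n H (sub (Fs j) a) (sub (Fs j') a)) →
    (∀ b → IsB n t b → ∀ j j' → j ≢ j' →
      ¬ OrbS 𝔽 n H (sub (Fs j) b) (sub (Fs j') b)) →
    ((c : Fin m → ℕ) → (∀ j → HasCard (_≈F_ 𝔽 n t) (OrbF 𝔽 n t H (Fs j)) (c j)) →
      HasCard (_≈F_ 𝔽 n t) (λ F → Σ (Fin m) λ j → OrbF 𝔽 n t H (Fs j) F) (sumℕ c))
    ×
    (IsOptimum 𝔽 n t (λ F → Σ (Fin m) λ j → OrbF 𝔽 n t H (Fs j) F)
      ⇔
     ((∀ a → IsA n t a →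
        MaxDistS 𝔽 n (t a) (λ U → Σ (Fin m) λ j → OrbS 𝔽 n H (sub (Fs j) a) U))
      ×
      (∀ b → IsB n t b →
        MaxDistS 𝔽 n (t b) (λ U → Σ (Fin m) λ j → OrbS 𝔽 n H (sub (Fs j) b) U))))
theorem4p13 𝔽 n r t 0<r type m Fs H disjoint sep-a sep-b =
    card-⋃ (proj₁ separated₀) (proj₂ separated₀)
  , mk⇔ (optimum⇒maxDist type i₀ sep-a sep-b) (maxDist⇒optimum type i₀ sep-a sep-b)
  where
  open UnionOfOrbits 𝔽 n t Fs H disjoint
  i₀ : Fin r
  i₀ = Fin.fromℕ< 0<r
  separated₀ : Σ (Fin r) SeparatedAt
  separated₀ = [ (λ (_ , a , isA) → a , sep-a a isA) , (λ (_ , b , isB) → b , sep-b b isB) ]′ (a-or-b n t i₀)
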